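{- Let $a>0$ be an integer and $s\in\{0,1\}$, with $(a,s)\neq(1,1)$ and $(a,s)\neq(2,1)$. Let $S_{a,s}$ be the set of finite sequences of positive integers with alternant $a$ and length parity $s$, and let $Z_{a,s}$ be the set of Zagier-reduced binary quadratic forms of discriminant $a^2+(-1)^s\cdot 4$. Then: (1) for every $\vec q\in S_{a,s}$, the form $\phi_{a,s}(\vec q)$ lies in $Z_{a,s}$; for every $f\in Z_{a,s}$, the sequence $\psi_{a,s}(f)$ lies in $S_{a,s}$; and $\psi_{a,s}\circ\phi_{a,s}$ is the identity on $S_{a,s}$ and $\phi_{a,s}\circ\psi_{a,s}$ is the identity on $Z_{a,s}$, so that $\phi_{a,s}$ and $\psi_{a,s}$ are mutually inverse bijections; (2) Zagier reduction corresponds to kneading under these bijections: if $f\in Z_{a,s}$ and $f'$ is the form obtained from $f$ by one Zagier reduction step, then $f'\in Z_{a,s}$ and $\psi_{a,s}(f')$ is the sequence obtained by kneading $\psi_{a,s}(f)$.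
   Context: A (binary quadratic) form is $Ax^2+Bxy+Cy^2$ with $A,B,C\in\mathbb Z$; its discriminant is $B^2-4AC$. A matrix $\begin{pmatrix}\alpha&\beta\\ \gamma&\delta\end{pmatrix}\in SL_2(\mathbb Z)$ acts on a form $f(x,y)$ by sending it to $f(\alpha x+\beta y,\gamma x+\delta y)$. A form is Zagier-reduced if $A>0$, $C>0$ and $B>A+C$. A Zagier reduction step on a form $f=Ax^2+Bxy+Cy^2$ of positive nonsquare discriminant $D$ consists of taking the unique integer $n$ with $n-1<\frac{B+\sqrt D}{2A}<n$ and acting on $f$ by $\begin{pmatrix} n&1\\-1&0\end{pmatrix}$. Continuants: $[\,]=1$ (empty sequence), $[q_1]=q_1$, and $[q_1,\dots,q_l]=q_1[q_2,\dots,q_l]+[q_3,\dots,q_l]$; $[q_1,\dots,q_l]$ is the numerator of the continued fraction $q_1+\cfrac{1}{q_2+\cfrac{1}{\ddots+\cfrac1{q_l}}}$ in lowest terms. The alternant of a sequence $(q_1,\dots,q_l)$ of positive integers is $[q_1,\dots,q_l]-[q_2,\dots,q_{l-1}]$ if $l\ge 3$, is $q_1$ if $l=1$, and is $q_1q_2$ if $l=2$. The length parity of a finite sequence is $0$ if its length is even and $1$ if odd. The map $\psi_{a,s}:Z_{a,s}\to S_{a,s}$: for $f=Ax^2+Bxy+Cy^2$, put $z=(a+B)/2$ and let $\psi_{a,s}(f)$ be the sequence of partial quotients of the finite simple continued fraction expansion of $z/A$ (with positive integer quotients) chosen among the two possible expansions so that its length has parity $s$. The map $\phi_{a,s}$: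 for $(q_1,\dots,q_l)$, $\phi_{a,s}((q_1,\dots,q_l))=[q_2,\dots,q_l]x^2+([q_1,\dots,q_l]+[q_2,\dots,q_{l-1}])xy+[q_1,\dots,q_{l-1}]y^2$, interpreted as $x^2+q_1xy+y^2$ when $l=1$. Pinching the left end of a finite sequence of positive integers: $(x,y,z,\dots)\mapsto(1,x-1,y,z,\dots)$ if $x\ge2$, and $\mapsto(y+1,z,\dots)$ if $x=1$; the sequence $(1)$ and the empty sequence are left unchanged by pinching. Pinching the right end is defined symmetrically: $(\dots,z,y,x)\mapsto(\dots,z,y,x-1,1)$ if $x\ge 2$ and $\mapsto(\dots,z,y+1)$ if $x=1$. Kneading a sequence: remove its leftmost entry, pinch both ends of what remains (the order does not matter), and then append the removed entry on the right end. (So sequences of length 1 are fixed, and $(a,b)\mapsto(1,b-2,1,a)$ if $b\ge3$, $(a,b)\mapsto(b,a)$ if $b\in\{1,2\}$.) -}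

module Defs where

open import Data.Nat as ℕ using (ℕ; zero; suc; NonZero)
open import Data.Integer as ℤ using (ℤ; +_; ∣_∣; -1ℤ)
open import Data.List using (List; []; _∷_; _++_; [_]; reverse; length)
open import Data.List.Relation.Unary.All using (All)
open import Data.Maybe using (Maybe; just; nothing)
open import Data.Product using (_×_)
open import Data.Sum using (_⊎_)
open import Data.Empty using (⊥)
open import Relation.Binary.PropositionalEquality using (_≡_)
open import Relation.Nullary using (yes; no)

-- Binary quadratic forms  A x² + B x y + C y²

record Form : Set where
  constructor form
  field
    A B C : ℤ
open Form public

discriminant : Form → ℤ
discriminant f = B f ℤ.* B f ℤ.- (+ 4) ℤ.* A f ℤ.* C f

-- 2×2 integer matrix (α β ; γ δ)
record Mat : Set where
  constructor mat
  field
    α β γ δ : ℤ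
open Mat public

det : Mat → ℤ
det m = α m ℤ.* δ m ℤ.- β m ℤ.* γ m

evalForm : Form → ℤ → ℤ → ℤ
evalForm f x y = A f ℤ.* x ℤ.* x ℤ.+ B f ℤ.* x ℤ.* y ℤ.+ C f ℤ.* y ℤ.* y

-- action: f(x,y) ↦ f(αx+βy, γx+δy); coefficients obtained by expanding
act : Mat → Form → Form
act m f = form (evalForm f (α m) (γ m))
               ((+ 2) ℤ.* A f ℤ.* α m ℤ.* β m
                  ℤ.+ B f ℤ.* (α m ℤ.* δ m ℤ.+ β m ℤ.* γ m)
                  ℤ.+ (+ 2) ℤ.* C f ℤ.* γ m ℤ.* δ m)
               (evalForm f (β m) (δ m))

ZagierReduced : Form → Set
ZagierReduced f = (+ 0 ℤ.< A f) × (+ 0 ℤ.< C f) × (A f ℤ.+ C f ℤ.< B f)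

-- Comparisons of an integer with √D (for D ≥ 0), without real numbers:
--   x < √D  iff  x < 0 or x² < D ;   √D < y  iff  0 ≤ y and D < y²
LtSqrt : ℤ → ℤ → Set
LtSqrt x D = (x ℤ.< + 0) ⊎ (x ℤ.* x ℤ.< D)

SqrtLt : ℤ → ℤ → Set
SqrtLt D y = (+ 0 ℤ.≤ y) × (D ℤ.< y ℤ.* y)

-- ZagierIndex D f n :  n - 1 < (B + √D) / (2A) < n   (D = disc f)
ZagierIndex : ℤ → Form → ℤ → Set
ZagierIndex D f n with A f
... | a@(+ suc _) =
  LtSqrt ((+ 2) ℤ.* a ℤ.* (n ℤ.- + 1) ℤ.- B f) D
  × SqrtLt D ((+ 2) ℤ.* a ℤ.* n ℤ.- B f)
... | + zero = ⊥
... | a@(ℤ.-[1+ _ ]) =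
  LtSqrt ((+ 2) ℤ.* a ℤ.* n ℤ.- B f) D
  × SqrtLt D ((+ 2) ℤ.* a ℤ.* (n ℤ.- + 1) ℤ.- B f)

zagierMatrix : ℤ → Mat
zagierMatrix n = mat n (+ 1) -1ℤ (+ 0)

zagierStep : ℤ → Form → Form
zagierStep n f = act (zagierMatrix n) f

continuant : List ℕ → ℕ
continuant [] = 1
continuant (q ∷ []) = q
continuant (q₁ ∷ q₂ ∷ qs) = q₁ ℕ.* continuant (q₂ ∷ qs) ℕ.+ continuant qs

dropLast : List ℕ → List ℕ
dropLast [] = []
dropLast (x ∷ []) = []
dropLast (x ∷ y ∷ r) = x ∷ dropLast (y ∷ r)

dropFirst : List ℕ → List ℕ
dropFirst [] = []
dropFirst (x ∷ r) = r

alternant : List ℕ → Maybe ℤ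
alternant [] = nothing
alternant (q₁ ∷ []) = just (+ q₁)
alternant (q₁ ∷ q₂ ∷ []) = just (+ (q₁ ℕ.* q₂))
alternant qs@(_ ∷ _ ∷ _ ∷ _) =
  just (+ continuant qs ℤ.- + continuant (dropLast (dropFirst qs)))

lengthParity : List ℕ → ℕ
lengthParity qs = length qs ℕ.% 2

sign : ℕ → ℤ
sign s = -1ℤ ℤ.^ s

disc : ℕ → ℕ → ℤ
disc a s = + (a ℕ.* a) ℤ.+ sign s ℤ.* + 4

InS : ℕ → ℕ → List ℕ → Set
InS a s qs = All (0 ℕ.<_) qs × alternant qs ≡ just (+ a) × lengthParity qs ≡ s

InZ : ℕ → ℕ → Form → Set
InZ a s f = ZagierReduced f × discriminant f ≡ disc a s

phi : ℕ → ℕ → List ℕ → Form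
phi a s [] = form (+ 1) (+ 0) (+ 1)   -- not used (∅ ∉ S_{a,s})
phi a s (q ∷ []) = form (+ 1) (+ q) (+ 1)
phi a s qs@(_ ∷ _ ∷ _) =
  form (+ continuant (dropFirst qs))
       (+ (continuant qs ℕ.+ continuant (dropLast (dropFirst qs))))
       (+ continuant (dropLast qs))

-- Continued fractions (Euclid's algorithm; fuel is always sufficient
-- when fuel > denominator)

cfAux : ℕ → ℕ → ℕ → List ℕ
cfAux zero p q = []
cfAux (suc k) p zero = []
cfAux (suc k) p (suc q) with p ℕ.% suc q
... | zero = (p ℕ./ suc q) ∷ []
... | suc r = (p ℕ./ suc q) ∷ cfAux k (suc q) (suc r)

cfExpansion : ℕ → ℕ → List ℕ
cfExpansion p q = cfAux (suc q) p q

-- other expansion: (…, k) with k ≥ 2 ↦ (…, k-1, 1);  (…, m, 1) ↦ (…, m+1)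
altRev : List ℕ → List ℕ
altRev (suc (suc k) ∷ r) = 1 ∷ suc k ∷ r
altRev (1 ∷ m ∷ r) = suc m ∷ r
altRev r = r

altExpansion : List ℕ → List ℕ
altExpansion qs = reverse (altRev (reverse qs))

chooseParity : ℕ → List ℕ → List ℕ
chooseParity s e with lengthParity e ℕ.≟ s
... | yes _ = e
... | no _ = altExpansion e

-- ψ_{a,s}(f): expansion of z / A with z = (a+B)/2, i.e. of (a+B)/(2A),
-- of length parity s
psi : ℕ → ℕ → Form → List ℕ
psi a s f = chooseParity s (cfExpansion ∣ + a ℤ.+ B f ∣ (2 ℕ.* ∣ A f ∣))

pinchLeft : List ℕ → List ℕ
pinchLeft (suc (suc x) ∷ r) = 1 ∷ suc x ∷ r
pinchLeft (1 ∷ y ∷ r) = suc y ∷ r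
pinchLeft r = r

pinchRight : List ℕ → List ℕ
pinchRight qs = reverse (pinchLeft (reverse qs))

knead : List ℕ → List ℕ
knead [] = []
knead (x ∷ r) = pinchRight (pinchLeft r) ++ [ x ]

module Submission where

-- Everything is computed through the continuant matrix of q = (q₁,…,qₗ),
--   cmat q = M(q₁)⋯M(qₗ) = ( P R ; Q S ) = ( [q]  [q₁…qₗ₋₁] ; [q₂…qₗ]  [q₂…qₗ₋₁] ),
-- whose determinant is (−1)^l; then φ(q) = (Q, P + S, R) and alternant q = P − S.  Then:
--  * φ(S) ⊆ Z: P = a + S and the determinant give the discriminant; a gap
--    computation gives B > A + C (the exception (1, y, 1) has (a, s) = (2, 1)).
--  * ψ ∘ φ = id: Euclid's algorithm recovers q from P/Q up to merging a final 1,
--    which ψ undoes by choosing the parity.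
--  * φ ∘ ψ = id and ψ(Z) ⊆ S: a form (A, a + 2w, C) in Z has 1 ≤ A ≤ a + w with
--    gcd(a + w, A) = 1, so (a + w)/A has a canonical expansion L; coprimality
--    then forces cmat L to be the matrix of the form.
--  * Kneading: pinching both ends of (q₂,…,qₗ) turns φ(q) into the image of the
--    Zagier step with n = q₁ + 1 (plus the short cases (a) and (x, 1)); since the
--    index of a step is unique, the step of the theorem is this one.

open import Defs
open import Data.Nat as ℕ using (ℕ; zero; suc; _+_; _*_; _∸_; _≤_; _<_; z≤n; s≤s; NonZero)
import Data.Nat.Properties as NP
import Data.Nat.Tactic.RingSolver as NS
open import Data.Nat.DivMod using (_%_; _/_)
import Data.Nat.DivMod as DM
open import Data.Nat.Divisibility using (_∣_; ∣m+n∣m⇒∣n; ∣n⇒∣m*n; ∣m⇒∣m*n; ∣1⇒≡1; ∣⇒≤; ∣-refl; ∣n∣m%n⇒∣m; m%n≡0⇒n∣m)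
open import Data.Nat.Coprimality using (Coprime; coprime-divisor)
import Data.Nat.Coprimality as CP
open import Data.Integer as ℤ using (ℤ; +_; -1ℤ; +<+; +≤+)
import Data.Integer.Properties as ZP
import Data.Integer.Tactic.RingSolver as ZS
open import Data.List using (List; []; _∷_; _++_; [_]; reverse; length; _∷ʳ_; initLast; _∷ʳ′_)
import Data.List.Properties as LP
open import Data.List.Relation.Unary.All using (All; []; _∷_)
import Data.List.Relation.Unary.All.Properties as AP
open import Data.Maybe using (just)
import Data.Maybe.Properties as MP
open import Data.Product using (_×_; _,_; proj₁; proj₂; Σ; ∃)
open import Data.Sum using (_⊎_; inj₁; inj₂)
open import Data.Unit using (⊤; tt)
open import Data.Empty using (⊥; ⊥-elim)
open import Relation.Binary.PropositionalEquality hiding ([_])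
open import Relation.Binary.Definitions using (tri<; tri≈; tri>)
open import Function using (_∘′_)
open import Relation.Nullary using (¬_; yes; no)

-- Continuant matrices

-- For q = (q₁,…,qₗ) the product  M(q₁)⋯M(qₗ)  with  M(x) = (x 1 ; 1 0)
-- is the matrix  ( [q₁…qₗ]  [q₁…qₗ₋₁] ; [q₂…qₗ]  [q₂…qₗ₋₁] ).  Its four
-- entries are named after the part of q whose continuant they are.
record ContMat : Set where
  constructor cm
  field
    whole front back inner : ℕ
open ContMat public

consMat : ℕ → ContMat → ContMat
consMat x (cm P R Q S) = cm (x * P + Q) (x * R + S) P R

cmat : List ℕ → ContMat
cmat [] = cm 1 0 0 1
cmat (x ∷ l) = consMat x (cmat l)

_⊗_ : ContMat → ContMat → ContMat
cm P R Q S ⊗ cm P' R' Q' S' =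
  cm (P * P' + R * Q') (P * R' + R * S') (Q * P' + S * Q') (Q * R' + S * S')

cm-cong : ∀ {a b c d a' b' c' d'} → a ≡ a' → b ≡ b' → c ≡ c' → d ≡ d' →
  cm a b c d ≡ cm a' b' c' d'
cm-cong refl refl refl refl = refl

-- cmat is a monoid morphism from (List ℕ, ++) to matrix multiplication;
-- this is how the right end of a sequence is controlled.
cmat-++ : ∀ xs ys → cmat (xs ++ ys) ≡ cmat xs ⊗ cmat ys
cmat-++ [] ys = sym (identity-⊗ (cmat ys))
  where
  unitˡ : ∀ (P Q : ℕ) → 1 * P + 0 * Q ≡ P
  unitˡ = NS.solve-∀
  unitʳ : ∀ (P Q : ℕ) → 0 * P + 1 * Q ≡ Q
  unitʳ = NS.solve-∀
  identity-⊗ : ∀ X → cmat [] ⊗ X ≡ X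
  identity-⊗ (cm P R Q S) = cm-cong (unitˡ P Q) (unitˡ R S) (unitʳ P Q) (unitʳ R S)
cmat-++ (x ∷ xs) ys = trans (cong (consMat x) (cmat-++ xs ys)) (consMat-⊗ x (cmat xs) (cmat ys))
  where
  assoc : ∀ (x a b c d e f g h : ℕ) →
    x * (a * e + b * g) + (c * e + d * g) ≡ (x * a + c) * e + (x * b + d) * g
  assoc = NS.solve-∀
  consMat-⊗ : ∀ x X Y → consMat x (X ⊗ Y) ≡ consMat x X ⊗ Y
  consMat-⊗ x (cm a b c d) (cm e f g h) =
    cm-cong (assoc x a b c d e f g h) (assoc x a b c d f e h g) refl refl

continuant≡whole : ∀ l → continuant l ≡ whole (cmat l)
continuant≡whole [] = refl
continuant≡whole (x ∷ []) = sym (trans (NP.+-identityʳ (x * 1)) (NP.*-identityʳ x))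
continuant≡whole (x ∷ y ∷ l) =
  cong₂ (λ u v → x * u + v) (continuant≡whole (y ∷ l)) (continuant≡whole l)

continuant-dropLast≡front : ∀ x l → continuant (dropLast (x ∷ l)) ≡ front (cmat (x ∷ l))
continuant-dropLast≡front x [] = cong (_+ 1) (sym (NP.*-zeroʳ x))
continuant-dropLast≡front x (y ∷ []) = lemma x y
  where
  lemma : ∀ x y → x ≡ x * (y * 0 + 1) + 0
  lemma = NS.solve-∀
continuant-dropLast≡front x (y ∷ z ∷ l) =
  cong₂ (λ u v → x * u + v) (continuant-dropLast≡front y (z ∷ l)) (continuant-dropLast≡front z l)

parity : ℕ → ℕ
parity zero = 0
parity (suc zero) = 1
parity (suc (suc n)) = parity n

parity≤1 : ∀ n → parity n ≤ 1
parity≤1 zero = z≤n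
parity≤1 (suc zero) = s≤s z≤n
parity≤1 (suc (suc n)) = parity≤1 n

parity-suc : ∀ n → parity (suc n) ≡ 1 ∸ parity n
parity-suc zero = refl
parity-suc (suc zero) = refl
parity-suc (suc (suc n)) = parity-suc n

lengthParity≡parity : ∀ l → lengthParity l ≡ parity (length l)
lengthParity≡parity l = %2≡parity (length l)
  where
  %2≡parity : ∀ n → n % 2 ≡ parity n
  %2≡parity zero = refl
  %2≡parity (suc zero) = refl
  %2≡parity (suc (suc n)) =
    trans (trans (cong (_% 2) (NP.+-comm 2 n)) (DM.[m+n]%n≡m%n n 2)) (%2≡parity n)

-- det (cmat l) = (-1)^(length l), written without subtraction:
--   P S + [l odd] = Q R + [l even].
determinant : ∀ l → whole (cmat l) * inner (cmat l) + parity (length l)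
                  ≡ back (cmat l) * front (cmat l) + parity (suc (length l))
determinant [] = refl
determinant (x ∷ l) with cmat l | determinant l
... | cm P R Q S | h = step x P Q R S (parity (length l)) (parity (suc (length l))) h
  where
  step : ∀ x P Q R S e o → P * S + e ≡ Q * R + o → (x * P + Q) * R + o ≡ P * (x * R + S) + e
  step x P Q R S e o h = begin
    (x * P + Q) * R + o      ≡⟨ expandˡ x P Q R o ⟩
    x * P * R + (Q * R + o)  ≡⟨ cong (λ t → x * P * R + t) (sym h) ⟩
    x * P * R + (P * S + e)  ≡⟨ expandʳ x P R S e ⟩
    P * (x * R + S) + e      ∎
    where
    open ≡-Reasoning
    expandˡ : ∀ x P Q R o → (x * P + Q) * R + o ≡ x * P * R + (Q * R + o)
    expandˡ = NS.solve-∀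
    expandʳ : ∀ x P R S e → x * P * R + (P * S + e) ≡ P * (x * R + S) + e
    expandʳ = NS.solve-∀

Pos : List ℕ → Set
Pos = All (0 <_)

≤-scale : ∀ {x} P → 0 < x → P ≤ x * P
≤-scale {x} P px = subst (_≤ x * P) (NP.*-identityˡ P) (NP.*-monoˡ-≤ P px)

whole-pos : ∀ l → Pos l → 1 ≤ whole (cmat l)
whole-pos [] _ = s≤s z≤n
whole-pos (x ∷ l) (px ∷ pl) =
  NP.≤-trans (NP.≤-trans (whole-pos l pl) (≤-scale _ px)) (NP.m≤m+n (x * whole (cmat l)) _)

front-pos : ∀ x l → Pos (x ∷ l) → 1 ≤ front (cmat (x ∷ l))
front-pos x [] _ = subst (1 ≤_) (cong (_+ 1) (sym (NP.*-zeroʳ x))) (s≤s z≤n)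
front-pos x (y ∷ l) (px ∷ pl) =
  NP.≤-trans (front-pos y l pl) (NP.≤-trans (≤-scale _ px) (NP.m≤m+n (x * front (cmat (y ∷ l))) _))

-- A sequence can be pinched (at either end) unless it is () or (1);
-- these are exactly the sequences with continuant at least 2.
Pinchable : List ℕ → Set
Pinchable u = 2 ≤ whole (cmat u)

pinchable-or-one : ∀ y r → Pos (y ∷ r) → (y ∷ r ≡ [ 1 ]) ⊎ Pinchable (y ∷ r)
pinchable-or-one zero _ (() ∷ _)
pinchable-or-one (suc zero) [] _ = inj₁ refl
pinchable-or-one (suc (suc k)) [] _ =
  inj₂ (subst (2 ≤_) (sym (trans (NP.+-identityʳ _) (NP.*-identityʳ (suc (suc k))))) (s≤s (s≤s z≤n)))
pinchable-or-one x (y ∷ r) (px ∷ pr@(_ ∷ pr')) =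
  inj₂ (NP.+-mono-≤ (NP.≤-trans (whole-pos (y ∷ r) pr) (≤-scale _ px)) (whole-pos r pr'))

back<whole : ∀ y r → Pos (y ∷ r) → Pinchable (y ∷ r) → back (cmat (y ∷ r)) < whole (cmat (y ∷ r))
back<whole y [] _ big = big
back<whole y (z ∷ r) (py ∷ pr@(_ ∷ pr')) _ =
  NP.<-≤-trans (NP.m<m+n P (whole-pos r pr')) (NP.+-monoˡ-≤ (whole (cmat r)) (≤-scale P py))
  where P = whole (cmat (z ∷ r))

-- φ produces reduced forms

-- The two "gaps"  [q₁…qₗ] − [q₁…qₗ₋₁]  and  [q₂…qₗ] − [q₂…qₗ₋₁]
-- of the sequence x ∷ r, computed by the same recursion as cmat.
gaps : ℕ → List ℕ → ℕ × ℕ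
gaps x [] = (x ∸ 1 , 1)
gaps x (y ∷ r) = (x * proj₁ (gaps y r) + proj₂ (gaps y r) , proj₁ (gaps y r))

gaps-spec : ∀ x r → Pos (x ∷ r) →
  (whole (cmat (x ∷ r)) ≡ front (cmat (x ∷ r)) + proj₁ (gaps x r))
  × (back (cmat (x ∷ r)) ≡ inner (cmat (x ∷ r)) + proj₂ (gaps x r))
gaps-spec (suc x) [] _ = lemma x , refl
  where
  lemma : ∀ x → suc x * 1 + 0 ≡ (suc x * 0 + 1) + x
  lemma = NS.solve-∀
gaps-spec x (y ∷ r) (_ ∷ pr) with gaps-spec y r pr
... | h₁ , h₂ = trans (cong₂ (λ u v → x * u + v) h₁ h₂) (lemma x _ _ _ _) , h₁
  where
  lemma : ∀ x R d S e → x * (R + d) + (S + e) ≡ (x * R + S) + (x * d + e)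
  lemma = NS.solve-∀

front≤whole : ∀ x r → Pos (x ∷ r) → front (cmat (x ∷ r)) ≤ whole (cmat (x ∷ r))
front≤whole x r p = subst (front (cmat (x ∷ r)) ≤_) (sym (proj₁ (gaps-spec x r p))) (NP.m≤m+n _ _)

gaps-zero : ∀ x r → Pos (x ∷ r) → proj₁ (gaps x r) ≡ 0 → (x ≡ 1) × (r ≡ [])
gaps-zero (suc zero) [] _ _ = refl , refl
gaps-zero (suc (suc x)) [] _ ()
gaps-zero x (y ∷ r) (px ∷ pr) h with proj₁ (gaps y r) in eq₁ | proj₂ (gaps y r) in eq₂
... | d | suc e with () ← NP.m+n≡0⇒n≡0 (x * d) h
... | d | zero with gaps-zero y r pr (trans eq₁ d≡0)
  where
  d≡0 : d ≡ 0
  d≡0 = NP.*-cancelˡ-≡ d 0 x ⦃ ℕ.>-nonZero px ⦄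
          (trans (NP.m+n≡0⇒m≡0 (x * d) h) (sym (NP.*-zeroʳ x)))
... | refl , refl with () ← eq₂

excess⇒< : ∀ {a b k} → a ≡ b + k → 1 ≤ k → b < a
excess⇒< {b = b} refl k≥1 = NP.m<m+n b k≥1

reduced-excess : ∀ x y r → Pos (y ∷ r) →
  whole (cmat (suc x ∷ y ∷ r)) + inner (cmat (suc x ∷ y ∷ r)) ≡
  (back (cmat (suc x ∷ y ∷ r)) + front (cmat (suc x ∷ y ∷ r))) + (x * proj₁ (gaps y r) + proj₂ (gaps y r))
reduced-excess x y r pr with gaps-spec y r pr
... | h₁ , h₂ = begin
  suc x * P + Q + R                    ≡⟨ cong₂ (λ u v → suc x * u + v + R) h₁ h₂ ⟩
  suc x * (R + d) + (S + e) + R        ≡⟨ lemma x R d S e ⟩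
  (R + d) + (suc x * R + S) + (x * d + e) ≡⟨ cong (λ u → u + (suc x * R + S) + (x * d + e)) (sym h₁) ⟩
  P + (suc x * R + S) + (x * d + e)    ∎
  where
  open ≡-Reasoning
  P = whole (cmat (y ∷ r)); Q = back (cmat (y ∷ r)); R = front (cmat (y ∷ r)); S = inner (cmat (y ∷ r))
  d = proj₁ (gaps y r); e = proj₂ (gaps y r)
  lemma : ∀ x R d S e → suc x * (R + d) + (S + e) + R ≡ ((R + d) + (suc x * R + S)) + (x * d + e)
  lemma = NS.solve-∀

reduced-or-exceptional : ∀ x y r → Pos (x ∷ y ∷ r) →
  ((x ≡ 1) × (r ≡ [ 1 ])) ⊎
  (back (cmat (x ∷ y ∷ r)) + front (cmat (x ∷ y ∷ r)) < whole (cmat (x ∷ y ∷ r)) + inner (cmat (x ∷ y ∷ r)))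
reduced-or-exceptional (suc x) y [] (_ ∷ pr) =
  inj₂ (excess⇒< (reduced-excess x y [] pr) (subst (1 ≤_) (sym (NP.+-comm (x * _) 1)) (s≤s z≤n)))
reduced-or-exceptional (suc x) y (z ∷ r) (_ ∷ pr@(_ ∷ pr'))
  with proj₁ (gaps z r) in eqz | reduced-excess x y (z ∷ r) pr
... | suc e | excess = inj₂ (excess⇒< excess (subst (1 ≤_) (sym (NP.+-suc (x * _) e)) (s≤s z≤n)))
... | zero | excess with gaps-zero z r pr' eqz | x
... | refl , refl | zero = inj₁ (refl , refl)
... | refl , refl | suc x' = inj₂ (excess⇒< excess (subst (1 ≤_) (sym (lemma x' y)) (s≤s z≤n)))
  where
  lemma : ∀ x y → suc x * (y * 0 + 1) + 0 ≡ suc x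
  lemma = NS.solve-∀


-- Pinching

-- Pinching the left end keeps the first row of the continuant matrix and
-- replaces the second row by its complement in the first one.
PinchedLeft : ContMat → ContMat → Set
PinchedLeft X Y = (whole X ≡ whole Y) × (front X ≡ front Y)
                  × (back X + back Y ≡ whole X) × (inner X + inner Y ≡ front X)

-- Symmetrically, pinching the right end keeps the first column.
PinchedRight : ContMat → ContMat → Set
PinchedRight X Y = (whole X ≡ whole Y) × (back X ≡ back Y)
                   × (front X + front Y ≡ whole X) × (inner X + inner Y ≡ back X)

PinchedLeft-sym : ∀ {X Y} → PinchedLeft X Y → PinchedLeft Y X
PinchedLeft-sym {X} {Y} (a , b , c , d) =
  sym a , sym b , trans (NP.+-comm (back Y) (back X)) (trans c a) , trans (NP.+-comm (inner Y) (inner X)) (trans d b)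

PinchedRight-sym : ∀ {X Y} → PinchedRight X Y → PinchedRight Y X
PinchedRight-sym {X} {Y} (a , b , c , d) =
  sym a , sym b , trans (NP.+-comm (front Y) (front X)) (trans c a) , trans (NP.+-comm (inner Y) (inner X)) (trans d b)

pinchedLeft-step : ∀ z ys → PinchedLeft (cmat (suc z ∷ ys)) (cmat (1 ∷ z ∷ ys))
pinchedLeft-step z ys with cmat ys
... | cm P R Q S = keep z P Q , keep z R S , split z P Q , split z R S
  where
  keep : ∀ z P Q → suc z * P + Q ≡ 1 * (z * P + Q) + P
  keep = NS.solve-∀
  split : ∀ z P Q → P + (z * P + Q) ≡ suc z * P + Q
  split = NS.solve-∀

pinchedRight-step : ∀ ys z → PinchedRight (cmat (ys ++ [ suc z ])) (cmat (ys ++ (z ∷ 1 ∷ [])))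
pinchedRight-step ys z rewrite cmat-++ ys [ suc z ] | cmat-++ ys (z ∷ 1 ∷ []) with cmat ys
... | cm P R Q S = keep z P R , keep z Q S , split z P R , split z Q S
  where
  keep : ∀ z P R → P * (suc z * 1 + 0) + R * 1 ≡ P * (z * (1 * 1 + 0) + 1) + R * (1 * 1 + 0)
  keep = NS.solve-∀
  split : ∀ z P R → P * (suc z * 0 + 1) + R * 0 + (P * (z * (1 * 0 + 1) + 0) + R * (1 * 0 + 1))
                    ≡ P * (suc z * 1 + 0) + R * 1
  split = NS.solve-∀

DifferByOne : ℕ → ℕ → Set
DifferByOne m n = (suc m ≡ n) ⊎ (suc n ≡ m)

flip-flip : ∀ n → 1 ∸ (1 ∸ parity n) ≡ parity n
flip-flip n = flip (parity n) (parity≤1 n)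
  where
  flip : ∀ p → p ≤ 1 → 1 ∸ (1 ∸ p) ≡ p
  flip zero _ = refl
  flip (suc zero) _ = refl
  flip (suc (suc p)) (s≤s ())

parity-differByOne : ∀ {m n} → DifferByOne m n → parity n ≡ 1 ∸ parity m
parity-differByOne {m} (inj₁ refl) = parity-suc m
parity-differByOne {n = n} (inj₂ refl) = trans (sym (flip-flip n)) (cong (1 ∸_) (sym (parity-suc n)))

length-snoc : ∀ (ys : List ℕ) (y : ℕ) → length (ys ++ [ y ]) ≡ suc (length ys)
length-snoc ys y = trans (LP.length-++ ys {[ y ]}) (NP.+-comm (length ys) 1)

length-snoc₂ : ∀ (ys : List ℕ) (a b : ℕ) → length (ys ++ (a ∷ b ∷ [])) ≡ suc (suc (length ys))
length-snoc₂ ys a b = trans (LP.length-++ ys {a ∷ b ∷ []}) (NP.+-comm (length ys) 2)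

PinchFacts : (List ℕ → List ℕ) → (ContMat → ContMat → Set) → List ℕ → Set
PinchFacts pinch Rel u = Rel (cmat u) (cmat (pinch u)) × Pos (pinch u) × DifferByOne (length u) (length (pinch u))

pinchLeft-facts : ∀ u → Pos u → Pinchable u → PinchFacts pinchLeft PinchedLeft u
pinchLeft-facts [] _ (s≤s ())
pinchLeft-facts (zero ∷ u) (() ∷ _) _
pinchLeft-facts (suc zero ∷ []) _ (s≤s ())
pinchLeft-facts (suc zero ∷ y ∷ u) (_ ∷ _ ∷ pu) _ =
  PinchedLeft-sym {cmat (suc y ∷ u)} (pinchedLeft-step y u) , s≤s z≤n ∷ pu , inj₂ refl
pinchLeft-facts (suc (suc x) ∷ u) (_ ∷ pu) _ =
  pinchedLeft-step (suc x) u , s≤s z≤n ∷ s≤s z≤n ∷ pu , inj₁ refl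

pinchRight-big : ∀ (ys : List ℕ) (k : ℕ) → pinchRight (ys ++ [ suc (suc k) ]) ≡ ys ++ (suc k ∷ 1 ∷ [])
pinchRight-big ys k rewrite LP.reverse-++ ys [ suc (suc k) ] =
  trans (reverse-cons₂ 1 (suc k) (reverse ys)) (cong (_++ (suc k ∷ 1 ∷ [])) (LP.reverse-involutive ys))
  where
  reverse-cons₂ : ∀ (a b : ℕ) (zs : List ℕ) → reverse (a ∷ b ∷ zs) ≡ reverse zs ++ (b ∷ a ∷ [])
  reverse-cons₂ a b zs = trans (LP.unfold-reverse a (b ∷ zs))
    (trans (cong (_∷ʳ a) (LP.unfold-reverse b zs)) (LP.++-assoc (reverse zs) [ b ] [ a ]))

pinchRight-one : ∀ (zs : List ℕ) (z : ℕ) → pinchRight (zs ++ (z ∷ 1 ∷ [])) ≡ zs ++ [ suc z ]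
pinchRight-one zs z rewrite LP.reverse-++ zs (z ∷ 1 ∷ []) =
  trans (LP.unfold-reverse (suc z) (reverse zs)) (cong (_∷ʳ suc z) (LP.reverse-involutive zs))

pinchRight-facts : ∀ u → Pos u → Pinchable u → PinchFacts pinchRight PinchedRight u
pinchRight-facts u pu bu with initLast u
pinchRight-facts .[] pu (s≤s ()) | []
... | ys ∷ʳ′ zero with () ∷ _ ← AP.++⁻ʳ ys pu
pinchRight-facts .(ys ++ [ suc (suc k) ]) pu bu | ys ∷ʳ′ suc (suc k) rewrite pinchRight-big ys k =
  pinchedRight-step ys (suc k) , AP.++⁺ (AP.++⁻ˡ ys pu) (s≤s z≤n ∷ s≤s z≤n ∷ []) ,
  inj₁ (trans (cong suc (length-snoc ys (suc (suc k)))) (sym (length-snoc₂ ys (suc k) 1)))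
pinchRight-facts .(ys ++ [ 1 ]) pu bu | ys ∷ʳ′ suc zero with initLast ys
pinchRight-facts .([] ++ [ 1 ]) pu (s≤s ()) | .[] ∷ʳ′ suc zero | []
... | zs ∷ʳ′ z rewrite LP.++-assoc zs [ z ] [ 1 ] | pinchRight-one zs z with AP.++⁻ zs pu
... | pzs , (pz ∷ _) =
  PinchedRight-sym {cmat (zs ++ [ suc z ])} (pinchedRight-step zs z) , AP.++⁺ pzs (s≤s z≤n ∷ []) ,
  inj₂ (trans (cong suc (length-snoc zs (suc z))) (sym (length-snoc₂ zs z 1)))

altExpansion≡pinchRight : ∀ u → altExpansion u ≡ pinchRight u
altExpansion≡pinchRight u = cong reverse (altRev≡pinchLeft (reverse u))
  where
  altRev≡pinchLeft : ∀ u → altRev u ≡ pinchLeft u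
  altRev≡pinchLeft [] = refl
  altRev≡pinchLeft (zero ∷ u) = refl
  altRev≡pinchLeft (suc zero ∷ []) = refl
  altRev≡pinchLeft (suc zero ∷ y ∷ u) = refl
  altRev≡pinchLeft (suc (suc x) ∷ u) = refl

-- Continued fractions

-- Euclid's algorithm (cfAux) returns the expansion whose last quotient
-- is at least 2, unless the expansion has length one.
LastAtLeast2 : List ℕ → Set
LastAtLeast2 [] = ⊥
LastAtLeast2 (y ∷ []) = 2 ≤ y
LastAtLeast2 (y ∷ z ∷ r) = LastAtLeast2 (z ∷ r)

Canonical : List ℕ → Set
Canonical [] = ⊥
Canonical (x ∷ []) = ⊤
Canonical (x ∷ y ∷ r) = LastAtLeast2 (y ∷ r)

canonical-tail : ∀ y r → LastAtLeast2 (y ∷ r) → Canonical (y ∷ r)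
canonical-tail y [] _ = tt
canonical-tail y (z ∷ r) h = h

canonical-snoc : ∀ ys k → Canonical (ys ++ [ suc (suc k) ])
canonical-snoc [] k = tt
canonical-snoc (y ∷ []) k = s≤s (s≤s z≤n)
canonical-snoc (y ∷ y' ∷ ys) k = lastAtLeast2 (y' ∷ ys)
  where
  lastAtLeast2 : ∀ ys → LastAtLeast2 (ys ++ [ suc (suc k) ])
  lastAtLeast2 [] = s≤s (s≤s z≤n)
  lastAtLeast2 (y' ∷ []) = s≤s (s≤s z≤n)
  lastAtLeast2 (y' ∷ y'' ∷ ys') = lastAtLeast2 (y'' ∷ ys')

lastAtLeast2⇒pinchable : ∀ y r → Pos (y ∷ r) → LastAtLeast2 (y ∷ r) → Pinchable (y ∷ r)
lastAtLeast2⇒pinchable y [] _ h = subst (2 ≤_) (sym (trans (NP.+-identityʳ (y * 1)) (NP.*-identityʳ y))) h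
lastAtLeast2⇒pinchable y (z ∷ r) p _ with pinchable-or-one y (z ∷ r) p
... | inj₂ big = big

divmod-unique : ∀ x q r p .{{_ : NonZero q}} → r < q → p ≡ r + x * q → (p % q ≡ r) × (p / q ≡ x)
divmod-unique x q r p r<q eq = p%q≡r , p/q≡x
  where
  p%q≡r : p % q ≡ r
  p%q≡r = trans (DM.%-congˡ eq) (trans (DM.[m+kn]%n≡m%n r x q) (DM.m<n⇒m%n≡m r<q))
  p/q≡x : p / q ≡ x
  p/q≡x = NP.*-cancelʳ-≡ (p / q) x q (NP.+-cancelˡ-≡ r _ _
            (trans (cong (_+ (p / q) * q) (sym p%q≡r)) (trans (sym (DM.m≡m%n+[m/n]*n p q)) eq)))

-- 2(xP + Q) divided by 2P leaves quotient x and remainder 2Q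
double-division : ∀ x P Q → 2 * (x * P + Q) ≡ 2 * Q + x * (2 * P)
double-division = NS.solve-∀

-- Euclid's algorithm recovers a canonical sequence l from the fraction
-- [l] / [tail l]  (here with numerator and denominator doubled, as in ψ).
cfAux-canonical : ∀ k l → Pos l → Canonical l → length l ≤ k →
  ∀ p q → p ≡ 2 * whole (cmat l) → q ≡ 2 * back (cmat l) → cfAux k p q ≡ l
cfAux-canonical k [] _ () _ _ _ _
cfAux-canonical (suc k) (x ∷ []) _ _ _ p .2 hp refl
  with p%2≡0 , p/2≡x ← divmod-unique x 2 0 p (s≤s z≤n) (trans hp (double-division x 1 0))
  rewrite p%2≡0 = cong (_∷ []) p/2≡x
cfAux-canonical (suc k) (x ∷ y ∷ r) (px ∷ pr) lg (s≤s len) p q hp refl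
  with 2 * whole (cmat (y ∷ r)) in eP | 2 * back (cmat (y ∷ r)) in eQ
... | zero | _ = ⊥-elim (NP.<⇒≢ (NP.≤-trans Q≥1 (NP.<⇒≤ Q<P)) (sym (NP.*-cancelˡ-≡ P 0 2 (trans eP (sym (NP.*-zeroʳ 2))))))
  where P = whole (cmat (y ∷ r)); Q<P = back<whole y r pr (lastAtLeast2⇒pinchable y r pr lg)
        Q≥1 = whole-pos r (AP.++⁻ʳ [ y ] pr)
... | suc _ | zero = ⊥-elim (NP.<⇒≢ (whole-pos r (AP.++⁻ʳ [ y ] pr)) (sym (NP.*-cancelˡ-≡ (back (cmat (y ∷ r))) 0 2 (trans eQ (sym (NP.*-zeroʳ 2))))))
... | suc q' | suc r₀
  with p%q≡r , p/q≡x ← divmod-unique x (suc q') (suc r₀) p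
         (subst₂ _<_ eQ eP (NP.*-monoʳ-< 2 (back<whole y r pr (lastAtLeast2⇒pinchable y r pr lg))))
         (trans hp (trans (double-division x _ _) (cong₂ (λ u v → u + x * v) eQ eP)))
  rewrite p%q≡r =
    cong₂ _∷_ p/q≡x (cfAux-canonical k (y ∷ r) pr (canonical-tail y r lg) len (suc q') (suc r₀) (sym eP) (sym eQ))

canonical-expansion : ∀ n A z → A ≤ n → 1 ≤ A → A ≤ z → Coprime z A →
  Σ (List ℕ) λ l → Pos l × Canonical l × (whole (cmat l) ≡ z) × (back (cmat l) ≡ A)
canonical-expansion n (suc zero) z _ _ z≥1 _ =
  [ z ] , (z≥1 ∷ []) , tt , trans (NP.+-identityʳ (z * 1)) (NP.*-identityʳ z) , refl
canonical-expansion (suc n) A@(suc (suc _)) z (s≤s A≤n) _ A≤z cop with z % A in er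
... | zero with () ← cop (m%n≡0⇒n∣m z A er , ∣-refl)
... | suc r with canonical-expansion n (suc r) A (NP.≤-trans (NP.≤-pred r<A) A≤n) (s≤s z≤n) (NP.<⇒≤ r<A) cop'
  where
  r<A : suc r < A
  r<A = subst (_< A) er (DM.m%n<n z A)
  cop' : Coprime A (suc r)
  cop' {d} (d∣A , d∣r) = cop (∣n∣m%n⇒∣m d∣A (subst (d ∣_) (sym er) d∣r) , d∣A)
... | l , pl , cl , eP , eQ =
  (z / A) ∷ l , DM.m≥n⇒m/n>0 A≤z ∷ pl , canonical l pl cl eP ,
  trans (cong₂ (λ u v → (z / A) * u + v) eP eQ)
        (trans (NP.+-comm ((z / A) * A) (suc r)) (sym (subst (λ t → z ≡ t + (z / A) * A) er (DM.m≡m%n+[m/n]*n z A)))) ,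
  eP
  where
  canonical : ∀ l → Pos l → Canonical l → whole (cmat l) ≡ A → Canonical ((z / A) ∷ l)
  canonical [] _ _ ()
  canonical (y ∷ []) _ _ e = subst (2 ≤_) (trans (sym e) (trans (NP.+-identityʳ (y * 1)) (NP.*-identityʳ y))) (s≤s (s≤s z≤n))
  canonical (y ∷ w ∷ rest) _ c _ = c

diff≡⇒sum≡ : ∀ X Y U V → + X ℤ.- + Y ≡ + U ℤ.- + V → X + V ≡ U + Y
diff≡⇒sum≡ X Y U V h = ZP.+-injective (begin
  + X ℤ.+ + V                       ≡⟨ regroup (+ X) (+ Y) (+ V) ⟩
  (+ X ℤ.- + Y) ℤ.+ (+ V ℤ.+ + Y)   ≡⟨ cong (ℤ._+ (+ V ℤ.+ + Y)) h ⟩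
  (+ U ℤ.- + V) ℤ.+ (+ V ℤ.+ + Y)   ≡⟨ cancel (+ U) (+ V) (+ Y) ⟩
  + U ℤ.+ + Y                       ∎)
  where
  open ≡-Reasoning
  regroup : ∀ (X Y V : ℤ) → X ℤ.+ V ≡ (X ℤ.- Y) ℤ.+ (V ℤ.+ Y)
  regroup = ZS.solve-∀
  cancel : ∀ (U V Y : ℤ) → (U ℤ.- V) ℤ.+ (V ℤ.+ Y) ≡ U ℤ.+ Y
  cancel = ZS.solve-∀

sum≡⇒diff≡ : ∀ X Y U V → X + V ≡ U + Y → + X ℤ.- + Y ≡ + U ℤ.- + V
sum≡⇒diff≡ X Y U V h = begin
  + X ℤ.- + Y                       ≡⟨ widen (+ X) (+ Y) (+ V) ⟩
  (+ X ℤ.+ + V) ℤ.- (+ V ℤ.+ + Y)   ≡⟨ cong (λ t → + t ℤ.- (+ V ℤ.+ + Y)) h ⟩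
  (+ U ℤ.+ + Y) ℤ.- (+ V ℤ.+ + Y)   ≡⟨ cancel (+ U) (+ V) (+ Y) ⟩
  + U ℤ.- + V                       ∎
  where
  open ≡-Reasoning
  widen : ∀ (X Y V : ℤ) → X ℤ.- Y ≡ (X ℤ.+ V) ℤ.- (V ℤ.+ Y)
  widen = ZS.solve-∀
  cancel : ∀ (U V Y : ℤ) → (U ℤ.+ Y) ℤ.- (V ℤ.+ Y) ≡ U ℤ.- V
  cancel = ZS.solve-∀

sum≡⇒pos≡diff : ∀ u v w → u + v ≡ w → + u ≡ + w ℤ.- + v
sum≡⇒pos≡diff u v w h = trans (sym (ZP.+-identityʳ (+ u))) (sum≡⇒diff≡ u 0 w v (trans h (sym (NP.+-identityʳ w))))

-- For s ≤ 1 the target discriminant  a² + (−1)^s·4  is  discPlus − discMinus.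
discPlus : ℕ → ℕ → ℕ
discPlus a s = a * a + 4 * (1 ∸ s)

discMinus : ℕ → ℕ
discMinus s = 4 * s

disc≡ : ∀ a s → s ≤ 1 → disc a s ≡ + discPlus a s ℤ.- + discMinus s
disc≡ a zero _ = lemma (+ (a * a))
  where
  lemma : ∀ (K : ℤ) → K ℤ.+ ℤ.1ℤ ℤ.* + 4 ≡ (K ℤ.+ + 4) ℤ.- + 0
  lemma = ZS.solve-∀
disc≡ a (suc zero) _ = lemma (+ (a * a))
  where
  lemma : ∀ (K : ℤ) → K ℤ.+ (-1ℤ ℤ.* ℤ.1ℤ) ℤ.* + 4 ≡ (K ℤ.+ + 0) ℤ.- + 4
  lemma = ZS.solve-∀
disc≡ a (suc (suc _)) (s≤s ())

DiscEq : ℕ → ℕ → ℕ → ℕ → ℕ → Set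
DiscEq a s A B C = B * B + discMinus s ≡ discPlus a s + 4 * A * C

discriminant≡ : ∀ A B C → discriminant (form (+ A) (+ B) (+ C)) ≡ + (B * B) ℤ.- + (4 * A * C)
discriminant≡ A B C =
  cong₂ ℤ._-_ (sym (ZP.pos-* B B)) (trans (cong (ℤ._* + C) (sym (ZP.pos-* 4 A))) (sym (ZP.pos-* (4 * A) C)))

discEq⇒ : ∀ a s A B C → s ≤ 1 → discriminant (form (+ A) (+ B) (+ C)) ≡ disc a s → DiscEq a s A B C
discEq⇒ a s A B C s≤1 h =
  diff≡⇒sum≡ (B * B) (4 * A * C) (discPlus a s) (discMinus s) (trans (sym (discriminant≡ A B C)) (trans h (disc≡ a s s≤1)))

⇒discEq : ∀ a s A B C → s ≤ 1 → DiscEq a s A B C → discriminant (form (+ A) (+ B) (+ C)) ≡ disc a s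
⇒discEq a s A B C s≤1 h =
  trans (discriminant≡ A B C) (trans (sum≡⇒diff≡ (B * B) (4 * A * C) (discPlus a s) (discMinus s) h) (sym (disc≡ a s s≤1)))

matForm : ContMat → Form
matForm M = form (+ back M) (+ (whole M + inner M)) (+ front M)

form-cong : ∀ {a b c a' b' c'} → a ≡ a' → b ≡ b' → c ≡ c' → form a b c ≡ form a' b' c'
form-cong refl refl refl = refl

form-injective : ∀ {a b c a' b' c'} → form a b c ≡ form a' b' c' → (a ≡ a') × (b ≡ b') × (c ≡ c')
form-injective refl = refl , refl , refl

phi≡matForm : ∀ a s q → 2 ≤ length q → phi a s q ≡ matForm (cmat q)
phi≡matForm a s (x ∷ []) (s≤s ())
phi≡matForm a s (x ∷ y ∷ r) _ =
  form-cong (cong +_ (continuant≡whole (y ∷ r)))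
            (cong +_ (cong₂ _+_ (continuant≡whole (x ∷ y ∷ r)) (continuant-dropLast≡front y r)))
            (cong +_ (continuant-dropLast≡front x (y ∷ r)))

-- alternant q = a  iff  P = a + S  (for length ≥ 2)
HasAlternant : ℕ → ContMat → Set
HasAlternant a M = whole M ≡ a + inner M

alternant≡ : ∀ x y r → alternant (x ∷ y ∷ r) ≡ just (+ whole (cmat (x ∷ y ∷ r)) ℤ.- + inner (cmat (x ∷ y ∷ r)))
alternant≡ x y [] =
  cong just (sym (trans (sum≡⇒diff≡ _ _ (x * y) 0 (trans (NP.+-identityʳ _) (lemma x y))) (ZP.+-identityʳ (+ (x * y)))))
  where
  lemma : ∀ x y → x * (y * 1 + 0) + 1 ≡ x * y + (y * 0 + 1)
  lemma = NS.solve-∀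
alternant≡ x y (z ∷ r) rewrite continuant≡whole (x ∷ y ∷ z ∷ r) | continuant-dropLast≡front y (z ∷ r) = refl

alternant⇒ : ∀ a q → 2 ≤ length q → alternant q ≡ just (+ a) → HasAlternant a (cmat q)
alternant⇒ a (x ∷ []) (s≤s ())
alternant⇒ a (x ∷ y ∷ r) _ h =
  trans (sym (NP.+-identityʳ _))
        (diff≡⇒sum≡ _ _ a 0 (trans (MP.just-injective (trans (sym (alternant≡ x y r)) h)) (sym (ZP.+-identityʳ (+ a)))))

⇒alternant : ∀ a q → 2 ≤ length q → HasAlternant a (cmat q) → alternant q ≡ just (+ a)
⇒alternant a (x ∷ []) (s≤s ())
⇒alternant a (x ∷ y ∷ r) _ h =
  trans (alternant≡ x y r) (cong just (trans (sum≡⇒diff≡ _ _ a 0 (trans (NP.+-identityʳ _) h)) (ZP.+-identityʳ (+ a))))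

record Admissible (a s : ℕ) : Set where
  field
    a>0 : 0 < a
    s≤1 : s ≤ 1
    not-1-1 : ¬ (a ≡ 1 × s ≡ 1)
    not-2-1 : ¬ (a ≡ 2 × s ≡ 1)
open Admissible

a≥3 : ∀ {a} → Admissible a 1 → 2 < a
a≥3 {zero} H with () ← a>0 H
a≥3 {suc zero} H = ⊥-elim (not-1-1 H (refl , refl))
a≥3 {suc (suc zero)} H = ⊥-elim (not-2-1 H (refl , refl))
a≥3 {suc (suc (suc a))} _ = s≤s (s≤s (s≤s z≤n))

determinant-parity : ∀ l s → parity (length l) ≡ s →
  whole (cmat l) * inner (cmat l) + s ≡ back (cmat l) * front (cmat l) + (1 ∸ s)
determinant-parity l s refl =
  subst (λ t → whole (cmat l) * inner (cmat l) + s ≡ back (cmat l) * front (cmat l) + t)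
        (parity-suc (length l)) (determinant l)

matForm-discEq : ∀ a s S Q R → (a + S) * S + s ≡ Q * R + (1 ∸ s) → DiscEq a s Q (a + S + S) R
matForm-discEq a s S Q R det = begin
  (a + S + S) * (a + S + S) + 4 * s  ≡⟨ expand a S s ⟩
  a * a + 4 * ((a + S) * S + s)      ≡⟨ cong (λ t → a * a + 4 * t) det ⟩
  a * a + 4 * (Q * R + (1 ∸ s))      ≡⟨ regroup a Q R (1 ∸ s) ⟩
  a * a + 4 * (1 ∸ s) + 4 * Q * R    ∎
  where
  open ≡-Reasoning
  expand : ∀ a S s → (a + S + S) * (a + S + S) + 4 * s ≡ a * a + 4 * ((a + S) * S + s)
  expand = NS.solve-∀
  regroup : ∀ a Q R o → a * a + 4 * (Q * R + o) ≡ a * a + 4 * o + 4 * Q * R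
  regroup = NS.solve-∀

InS⇒ : ∀ a s q → 2 ≤ length q → InS a s q →
  Pos q × HasAlternant a (cmat q) × parity (length q) ≡ s
InS⇒ a s q len (pq , alt , par) = pq , alternant⇒ a q len alt , trans (sym (lengthParity≡parity q)) par

⇒InS : ∀ a s q → 2 ≤ length q → Pos q → HasAlternant a (cmat q) → parity (length q) ≡ s → InS a s q
⇒InS a s q len pq alt par = pq , ⇒alternant a q len alt , trans (lengthParity≡parity q) par

phi-singleton : ∀ a s → Admissible a s → ∀ x → InS a s [ x ] → InZ a s (phi a s [ x ])
phi-singleton a s H x (_ , alt , par) with ZP.+-injective (MP.just-injective alt) | par
... | refl | refl =
  (+<+ (s≤s z≤n) , +<+ (s≤s z≤n) , +<+ (a≥3 H)) ,
  ⇒discEq a 1 1 a 1 (s≤1 H) (cong (_+ 4) (sym (NP.+-identityʳ (a * a))))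

phi-inZ : ∀ a s → Admissible a s → ∀ q → InS a s q → InZ a s (phi a s q)
phi-inZ a s H [] (_ , () , _)
phi-inZ a s H (x ∷ []) q∈S = phi-singleton a s H x q∈S
phi-inZ a s H q@(x ∷ y ∷ r) q∈S with InS⇒ a s q (s≤s (s≤s z≤n)) q∈S
... | pq , alt , par = subst (InZ a s) (sym (phi≡matForm a s q (s≤s (s≤s z≤n)))) (reduced , discEq)
  where
  M = cmat q
  discEq : discriminant (matForm M) ≡ disc a s
  discEq = ⇒discEq a s (back M) (whole M + inner M) (front M) (s≤1 H)
    (subst (λ P → DiscEq a s (back M) (P + inner M) (front M)) (sym alt)
      (matForm-discEq a s (inner M) (back M) (front M)
        (subst (λ P → P * inner M + s ≡ back M * front M + (1 ∸ s)) alt (determinant-parity q s par))))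
  reduced : ZagierReduced (matForm M)
  reduced with reduced-or-exceptional x y r pq
  ... | inj₂ lt = +<+ (whole-pos (y ∷ r) (AP.++⁻ʳ [ x ] pq)) , +<+ (front-pos x (y ∷ r) pq) , +<+ lt
  -- q = (1, y, 1) has alternant 2 and odd length, which is excluded
  ... | inj₁ (refl , refl) = ⊥-elim (not-2-1 H (NP.+-cancelʳ-≡ _ a 2 (trans (sym alt) (lemma y)) , sym par))
    where
    lemma : ∀ y → 1 * (y * 1 + 1) + 1 ≡ 2 + (y * 1 + 0)
    lemma = NS.solve-∀

-- ψ ∘ φ = id on S_{a,s}

chooseParity-same : ∀ s e → lengthParity e ≡ s → chooseParity s e ≡ e
chooseParity-same s e h with lengthParity e ℕ.≟ s
... | yes _ = refl
... | no ne = ⊥-elim (ne h)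

chooseParity-other : ∀ s e → lengthParity e ≢ s → chooseParity s e ≡ pinchRight e
chooseParity-other s e h with lengthParity e ℕ.≟ s
... | yes eq = ⊥-elim (h eq)
... | no _ = altExpansion≡pinchRight e

-- the fuel  1 + 2[tail l]  given to Euclid's algorithm by ψ suffices
length≤fuel : ∀ l → Pos l → length l ≤ suc (2 * back (cmat l))
length≤fuel [] _ = z≤n
length≤fuel (x ∷ r) (_ ∷ pr) = s≤s (NP.≤-trans (length≤whole r pr) (NP.m≤n*m (whole (cmat r)) 2))
  where
  length≤whole : ∀ r → Pos r → length r ≤ whole (cmat r)
  length≤whole [] _ = z≤n
  length≤whole (y ∷ []) (py ∷ _) = subst (1 ≤_) (sym (trans (NP.+-identityʳ (y * 1)) (NP.*-identityʳ y))) py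
  length≤whole (y ∷ z ∷ r) (py ∷ pr@(_ ∷ pr')) =
    subst (_≤ y * whole (cmat (z ∷ r)) + whole (cmat r)) (NP.+-comm (length (z ∷ r)) 1)
      (NP.+-mono-≤ (NP.≤-trans (length≤whole (z ∷ r) pr) (≤-scale _ py)) (whole-pos r pr'))

psi-canonical : ∀ a s A B C c → Pos c → Canonical c →
  a + B ≡ 2 * whole (cmat c) → back (cmat c) ≡ A → psi a s (form (+ A) (+ B) (+ C)) ≡ chooseParity s c
psi-canonical a s A B C c pc cc hB refl =
  cong (chooseParity s) (cfAux-canonical _ c pc cc (length≤fuel c pc) (a + B) _ hB refl)

psi-phi-canonical : ∀ a s q c → 2 ≤ length q → HasAlternant a (cmat q) → Pos c → Canonical c →
  whole (cmat c) ≡ whole (cmat q) → back (cmat c) ≡ back (cmat q) → psi a s (phi a s q) ≡ chooseParity s c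
psi-phi-canonical a s q c len alt pc cc eP eQ rewrite phi≡matForm a s q len =
  psi-canonical a s (back (cmat q)) (whole (cmat q) + inner (cmat q)) (front (cmat q)) c pc cc (trans (double a _ _ alt) (cong (2 *_) (sym eP))) eQ
  where
  double : ∀ a S P → P ≡ a + S → a + (P + S) ≡ 2 * P
  double a S .(a + S) refl = lemma a S
    where
    lemma : ∀ a S → a + ((a + S) + S) ≡ 2 * (a + S)
    lemma = NS.solve-∀

length-snoc-snoc : ∀ (zs : List ℕ) w z → 2 ≤ length ((zs ++ [ w ]) ++ [ z ])
length-snoc-snoc zs w z rewrite length-snoc (zs ++ [ w ]) z | length-snoc zs w = s≤s (s≤s z≤n)

psi-phi-long : ∀ a s zs w z → Pos ((zs ++ [ w ]) ++ [ z ]) → HasAlternant a (cmat ((zs ++ [ w ]) ++ [ z ])) →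
  parity (length ((zs ++ [ w ]) ++ [ z ])) ≡ s → psi a s (phi a s ((zs ++ [ w ]) ++ [ z ])) ≡ (zs ++ [ w ]) ++ [ z ]
psi-phi-long a s zs w zero pq _ _ with () ∷ _ ← AP.++⁻ʳ (zs ++ [ w ]) pq
-- q ends in a quotient ≥ 2: q is its own canonical expansion
psi-phi-long a s zs w (suc (suc k)) pq alt par =
  trans (psi-phi-canonical a s q q (length-snoc-snoc zs w _) alt pq (canonical-snoc (zs ++ [ w ]) k) refl refl)
        (chooseParity-same s q (trans (lengthParity≡parity q) par))
  where q = (zs ++ [ w ]) ++ [ suc (suc k) ]
psi-phi-long a s zs zero (suc zero) pq _ _ with () ∷ _ ← AP.++⁻ʳ zs (AP.++⁻ˡ (zs ++ [ 0 ]) pq)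
-- q ends in 1: its canonical expansion c merges the last two quotients
psi-phi-long a s zs (suc k) (suc zero) pq alt par =
  trans (psi-phi-canonical a s q c (length-snoc-snoc zs _ _) alt pc (canonical-snoc zs k)
                           (trans (proj₁ pinched) (cong (whole ∘′ cmat) (sym q≡)))
                           (trans (proj₁ (proj₂ pinched)) (cong (back ∘′ cmat) (sym q≡))))
        (trans (chooseParity-other s c parity≢) (trans (pinchRight-big zs k) (sym q≡)))
  where
  q = (zs ++ [ suc k ]) ++ [ 1 ]
  c = zs ++ [ suc (suc k) ]
  q≡ : q ≡ zs ++ (suc k ∷ 1 ∷ [])
  q≡ = LP.++-assoc zs [ suc k ] [ 1 ]
  pinched = pinchedRight-step zs (suc k)
  pc : Pos c
  pc = AP.++⁺ (AP.++⁻ˡ zs (AP.++⁻ˡ (zs ++ [ suc k ]) pq)) (s≤s z≤n ∷ [])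
  parity≢ : lengthParity c ≢ s
  parity≢ e = parity-suc≢ (suc (length zs)) (trans par-q (sym par-c))
    where
    par-q : parity (suc (suc (length zs))) ≡ s
    par-q = trans (cong parity (sym (trans (length-snoc (zs ++ [ suc k ]) 1) (cong suc (length-snoc zs (suc k)))))) par
    par-c : parity (suc (length zs)) ≡ s
    par-c = trans (cong parity (sym (length-snoc zs (suc (suc k))))) (trans (sym (lengthParity≡parity c)) e)
    parity-suc≢ : ∀ n → parity (suc n) ≢ parity n
    parity-suc≢ zero ()
    parity-suc≢ (suc zero) ()
    parity-suc≢ (suc (suc n)) = parity-suc≢ n

psi-phi : ∀ a s → Admissible a s → ∀ q → InS a s q → psi a s (phi a s q) ≡ q
psi-phi a s H q q∈S with initLast q
psi-phi a s H .[] (_ , () , _) | []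
... | ys ∷ʳ′ z with initLast ys
psi-phi a s H .([] ++ [ z ]) (pq , alt , par) | .[] ∷ʳ′ z | [] with refl ← ZP.+-injective (MP.just-injective alt) =
  trans (psi-canonical a s 1 a 1 [ a ] pq tt (double a) (NP.+-identityʳ 1)) (chooseParity-same s [ a ] par)
  where
  double : ∀ a → a + a ≡ 2 * (a * 1 + 0)
  double = NS.solve-∀
psi-phi a s H .((zs ++ [ w ]) ++ [ z ]) q∈S | .(zs ++ [ w ]) ∷ʳ′ z | zs ∷ʳ′ w
  with pq , alt , par ← InS⇒ a s ((zs ++ [ w ]) ++ [ z ]) (length-snoc-snoc zs w z) q∈S =
  psi-phi-long a s zs w z pq alt par

-- Every form in Z_{a,s} is  (A, a + 2w, C)  with  A, C ≥ 1,  a + 2w > A + C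
-- and the divided-by-four discriminant relation  w(a + w) + s = (1 − s) + AC.
record Shape (a s A C w : ℕ) : Set where
  field
    A≥1 : 1 ≤ A
    C≥1 : 1 ≤ C
    excess : ℕ
    B>A+C : a + 2 * w ≡ A + C + 1 + excess
    relation : w * (a + w) + s ≡ (1 ∸ s) + A * C

-- B ≥ a, since 4AC ≥ 4
a≤B : ∀ a s A B C → s ≤ 1 → 1 ≤ A → 1 ≤ C → DiscEq a s A B C → a ≤ B
a≤B a s A B C s≤1 A≥1 C≥1 h with NP.≤-<-connex a B
... | inj₁ le = le
... | inj₂ B<a = ⊥-elim (NP.<-irrefl h (NP.≤-<-trans (NP.+-monoʳ-≤ (B * B) (NP.*-monoʳ-≤ 4 s≤1))
       (NP.<-≤-trans (NP.+-monoˡ-< 4 (NP.*-mono-< B<a B<a))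
         (NP.+-mono-≤ (NP.m≤m+n (a * a) (4 * (1 ∸ s))) (NP.*-mono-≤ (NP.*-monoʳ-≤ 4 A≥1) C≥1)))))

-- B − a is even, since  (B − a)(B + a) ≡ 0 (mod 4)
B-a-even : ∀ a t s o A C → t * (2 * a + t) + 4 * s ≡ 4 * o + 4 * A * C → ∃ λ w → t ≡ 2 * w
B-a-even a t s o A C eq with t % 2 | DM.m≡m%n+[m/n]*n t 2 | DM.m%n<n t 2
... | zero | t≡ | _ = t / 2 , trans t≡ (NP.*-comm (t / 2) 2)
... | suc (suc _) | _ | s≤s (s≤s ())
... | suc zero | t≡ | _ = ⊥-elim (odd≢even (a + 2 * k + 2 * a * k + 2 * k * k + 2 * s) (2 * o + 2 * A * C) (begin
  1 + (a + 2 * k + 2 * a * k + 2 * k * k + 2 * s) * 2  ≡⟨ odd-side a k s ⟩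
  (1 + k * 2) * (2 * a + (1 + k * 2)) + 4 * s          ≡⟨ cong (λ u → u * (2 * a + u) + 4 * s) (sym t≡) ⟩
  t * (2 * a + t) + 4 * s                              ≡⟨ eq ⟩
  4 * o + 4 * A * C                                    ≡⟨ even-side o A C ⟩
  0 + (2 * o + 2 * A * C) * 2                          ∎))
  where
  open ≡-Reasoning
  k = t / 2
  odd-side : ∀ a h s → 1 + (a + 2 * h + 2 * a * h + 2 * h * h + 2 * s) * 2 ≡ (1 + h * 2) * (2 * a + (1 + h * 2)) + 4 * s
  odd-side = NS.solve-∀
  even-side : ∀ o A C → 4 * o + 4 * A * C ≡ 0 + (2 * o + 2 * A * C) * 2
  even-side = NS.solve-∀
  odd≢even : ∀ m n → 1 + m * 2 ≢ 0 + n * 2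
  odd≢even m n e with () ← trans (sym (DM.[m+kn]%n≡m%n 1 m 2)) (trans (cong (_% 2) e) (DM.[m+kn]%n≡m%n 0 n 2))

discEq-shift : ∀ a s A t C → DiscEq a s A (a + t) C → t * (2 * a + t) + 4 * s ≡ 4 * (1 ∸ s) + 4 * A * C
discEq-shift a s A t C h = NP.+-cancelˡ-≡ (a * a) _ _ (trans (sym (split a t s)) (trans h (regroup a (1 ∸ s) A C)))
  where
  split : ∀ a t s → (a + t) * (a + t) + 4 * s ≡ a * a + (t * (2 * a + t) + 4 * s)
  split = NS.solve-∀
  regroup : ∀ a o A C → a * a + 4 * o + 4 * A * C ≡ a * a + (4 * o + 4 * A * C)
  regroup = NS.solve-∀

reduced-shape : ∀ a s → s ≤ 1 → ∀ A B C → InZ a s (form (+ A) (+ B) (+ C)) →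
  Σ ℕ λ w → (B ≡ a + 2 * w) × Shape a s A C w
reduced-shape a s s≤1 A B C ((+<+ A≥1 , +<+ C≥1 , +<+ B>A+C) , disc-f)
  with t , refl ← NP.m≤n⇒∃[o]m+o≡n (a≤B a s A B C s≤1 A≥1 C≥1 (discEq⇒ a s A B C s≤1 disc-f))
  with w , refl ← B-a-even a t s (1 ∸ s) A C (discEq-shift a s A t C (discEq⇒ a s A (a + t) C s≤1 disc-f))
  with u , eu ← NP.m≤n⇒∃[o]m+o≡n B>A+C =
  w , refl , record
    { A≥1 = A≥1 ; C≥1 = C≥1 ; excess = u
    ; B>A+C = trans (sym eu) (shift A C u)
    ; relation = NP.*-cancelˡ-≡ _ _ 4 (trans (sym (quarter a w s))
                   (trans (discEq-shift a s A (2 * w) C (discEq⇒ a s A (a + 2 * w) C s≤1 disc-f)) (factor (1 ∸ s) A C))) }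
  where
  quarter : ∀ a w s → 2 * w * (2 * a + 2 * w) + 4 * s ≡ 4 * (w * (a + w) + s)
  quarter = NS.solve-∀
  factor : ∀ o A C → 4 * o + 4 * A * C ≡ 4 * (o + A * C)
  factor = NS.solve-∀
  shift : ∀ A C u → suc (A + C) + u ≡ A + C + 1 + u
  shift = NS.solve-∀

module _ {a s A C w : ℕ} (sh : Shape a s A C w) where
  open Shape sh

  -- A·B computed in two ways:  w(a + w) + A² + A + A·u + s = (1 − s) + A(a + 2w)
  AB-identity : w * (a + w) + A * A + A + A * excess + s ≡ (1 ∸ s) + A * (a + 2 * w)
  AB-identity = begin
    w * (a + w) + A * A + A + A * u + s       ≡⟨ regroup a w s A u ⟩
    (w * (a + w) + s) + (A * A + A + A * u)   ≡⟨ cong (_+ (A * A + A + A * u)) relation ⟩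
    ((1 ∸ s) + A * C) + (A * A + A + A * u)   ≡⟨ collect (1 ∸ s) A C u ⟩
    (1 ∸ s) + A * (A + C + 1 + u)             ≡⟨ cong (λ t → (1 ∸ s) + A * t) (sym B>A+C) ⟩
    (1 ∸ s) + A * (a + 2 * w)                 ∎
    where
    open ≡-Reasoning
    u = excess
    regroup : ∀ a w s A u → w * (a + w) + A * A + A + A * u + s ≡ (w * (a + w) + s) + (A * A + A + A * u)
    regroup = NS.solve-∀
    collect : ∀ o A C u → (o + A * C) + (A * A + A + A * u) ≡ o + A * (A + C + 1 + u)
    collect = NS.solve-∀

  -- the identity leaves room for an excess of at most 1 − s ≤ 1
  private
    no-excess : ∀ X K → X + K + s ≡ (1 ∸ s) + X → 2 ≤ K → ⊥
    no-excess X K h k≥2 = NP.<-irrefl refl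
      (NP.<-≤-trans (NP.≤-trans k≥2 (NP.m≤m+n K s)) (NP.≤-trans (NP.≤-reflexive K+s≡) (NP.m∸n≤m 1 s)))
      where
      K+s≡ : K + s ≡ 1 ∸ s
      K+s≡ = NP.+-cancelˡ-≡ X _ _ (trans (sym (NP.+-assoc X K s)) (trans h (NP.+-comm (1 ∸ s) X)))

  w≤A : 1 ≤ a → w ≤ A
  w≤A a≥1 with NP.≤-<-connex w A
  ... | inj₁ le = le
  ... | inj₂ A<w with NP.m≤n⇒∃[o]m+o≡n A<w | A≥1 | a≥1 | AB-identity
  ... | t , refl | s≤s {_} {A'} _ | s≤s {_} {a'} _ | identity =
    ⊥-elim (no-excess _ _ (trans (sym (expand A' a' t excess s)) identity) (s≤s (s≤s z≤n)))
    where
    expand : ∀ A' a' t u s → let A = suc A' ; a = suc a' ; w = suc A + t in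
      w * (a + w) + A * A + A + A * u + s ≡ A * (a + 2 * w) + (2 + (A' + a' + 1 + 2 * t + t * a + t * t + A * u)) + s
    expand = NS.solve-∀

  A≤a+w : A ≤ a + w
  A≤a+w with NP.≤-<-connex A (a + w)
  ... | inj₁ le = le
  ... | inj₂ a+w<A with NP.m≤n⇒∃[o]m+o≡n a+w<A | AB-identity
  ... | t , refl | identity =
    ⊥-elim (no-excess _ _ (trans (sym (expand a w t excess s)) identity) (s≤s (s≤s z≤n)))
    where
    expand : ∀ a w t u s → let A = suc (a + w) + t in
      w * (a + w) + A * A + A + A * u + s ≡ A * (a + 2 * w) + (2 + (a + 2 * t + a * t + t * t + a + w + t + A * u)) + s
    expand = NS.solve-∀

  -- a common divisor of a + w and A divides (1 − s) or s, hence 1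
  coprime : s ≤ 1 → Coprime (a + w) A
  coprime s≤1 {d} (d∣z , d∣A) = ∣1⇒≡1 (divides-one s s≤1 relation)
    where
    divides-one : ∀ s → s ≤ 1 → w * (a + w) + s ≡ (1 ∸ s) + A * C → d ∣ 1
    divides-one zero _ h =
      ∣m+n∣m⇒∣n (subst (d ∣_) (trans (sym (NP.+-identityʳ (w * (a + w)))) (trans h (NP.+-comm 1 (A * C))))
                         (∣n⇒∣m*n w d∣z))
                (∣m⇒∣m*n C d∣A)
    divides-one (suc zero) _ h = ∣m+n∣m⇒∣n (subst (d ∣_) (sym h) (∣m⇒∣m*n C d∣A)) (∣n⇒∣m*n w d∣z)
    divides-one (suc (suc _)) (s≤s ()) _

-- For s = 1 and A = 1 the form is (1, a, C) with w = 0, since otherwise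
-- C = w(a + w) + 1 would exceed B = a + 2w.
w≡0 : ∀ {a C w} → Shape a 1 1 C w → w ≡ 0
w≡0 {w = zero} _ = refl
w≡0 {a} {C} {suc t} sh = ⊥-elim (NP.m+1+n≢m (a + 2 * suc t)
  (sym (trans B>A+C (trans (cong (λ c → 1 + c + 1 + excess) C≡) (expand a t excess)))))
  where
  open Shape sh
  C≡ : C ≡ suc t * (a + suc t) + 1
  C≡ = sym (trans relation (NP.*-identityˡ C))
  expand : ∀ a t u → 1 + (suc t * (a + suc t) + 1) + 1 + u ≡ (a + 2 * suc t) + suc (suc (t * a + t * t + u))
  expand = NS.solve-∀

-- Every form in Z_{a,s} is φ of ψ of itself

-- Correcting the length parity of a canonical expansion keeps its first
-- column; the only exception is (1), which has no other expansion.
ParityCorrected : ℕ → List ℕ → List ℕ → Set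
ParityCorrected s c L = Pos L × parity (length L) ≡ s × whole (cmat L) ≡ whole (cmat c) × back (cmat L) ≡ back (cmat c)

parity-corrected : ∀ s c → s ≤ 1 → Pos c → Canonical c →
  ((c ≡ [ 1 ]) × (s ≡ 0)) ⊎ ParityCorrected s c (chooseParity s c)
parity-corrected s c s≤1 pc cc with lengthParity c ℕ.≟ s
... | yes e = inj₂ (pc , trans (sym (lengthParity≡parity c)) e , refl , refl)
parity-corrected s (x ∷ r) s≤1 pc cc | no ne with pinchable-or-one x r pc
... | inj₁ refl = inj₁ (refl , s≡0 s s≤1 ne)
  where
  s≡0 : ∀ s → s ≤ 1 → 1 ≢ s → s ≡ 0
  s≡0 zero _ _ = refl
  s≡0 (suc zero) _ n = ⊥-elim (n refl)
  s≡0 (suc (suc _)) (s≤s ()) _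
... | inj₂ big with rel , pos , adj ← pinchRight-facts (x ∷ r) pc big rewrite altExpansion≡pinchRight (x ∷ r) =
  inj₂ (pos , trans (parity-differByOne adj) (other (parity (length (x ∷ r))) s (parity≤1 (length (x ∷ r))) s≤1
                                              (λ e → ne (trans (lengthParity≡parity (x ∷ r)) e))) ,
        sym (proj₁ rel) , sym (proj₁ (proj₂ rel)))
  where
  other : ∀ p s → p ≤ 1 → s ≤ 1 → p ≢ s → 1 ∸ p ≡ s
  other zero zero _ _ ne = ⊥-elim (ne refl)
  other zero (suc zero) _ _ _ = refl
  other (suc zero) zero _ _ _ = refl
  other (suc zero) (suc zero) _ _ ne = ⊥-elim (ne refl)
  other (suc (suc p)) _ (s≤s ()) _ _
  other _ (suc (suc s)) _ (s≤s ()) _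

cross-cancel : ∀ X Y Z W s o → X + s ≡ W + o → Z + s ≡ Y + o → X + Y ≡ Z + W
cross-cancel X Y Z W s o h₁ h₂ =
  NP.+-cancelʳ-≡ (s + o) _ _ (trans (regroupˡ X Y s o) (trans (cong₂ _+_ h₁ (sym h₂)) (regroupʳ Z W s o)))
  where
  regroupˡ : ∀ X Y s o → (X + Y) + (s + o) ≡ (X + s) + (Y + o)
  regroupˡ = NS.solve-∀
  regroupʳ : ∀ Z W s o → (W + o) + (Z + s) ≡ (Z + W) + (s + o)
  regroupʳ = NS.solve-∀

coprime-divisor-bound : ∀ {A z} d → Coprime A z → A ∣ z * suc d → A ≤ suc d
coprime-divisor-bound d cop A∣ = ∣⇒≤ (coprime-divisor cop A∣)

coprime-box : ∀ z A S w R C → Coprime A z → 1 ≤ A → 1 ≤ S → w ≤ A → R ≤ z → 1 ≤ C →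
  z * S + A * C ≡ z * w + A * R → S ≡ w
coprime-box z A S w R C cop A≥1 S≥1 w≤A R≤z C≥1 key with NP.<-cmp S w
... | tri≈ _ e _ = e
-- S < w:  A ∣ z(w − S), so w > w − S ≥ A
... | tri< S<w _ _ with d , refl ← NP.m≤n⇒∃[o]m+o≡n S<w =
  ⊥-elim (NP.<-irrefl refl (NP.≤-trans (NP.≤-trans (s≤s (NP.+-monoˡ-≤ d S≥1)) w≤A) A≤d+1))
  where
  AC≡ : A * C ≡ z * suc d + A * R
  AC≡ = NP.+-cancelˡ-≡ (z * S) _ _
          (trans key (trans (cong (λ t → z * t + A * R) (sym (NP.+-suc S d))) (distrib z S d (A * R))))
    where
    distrib : ∀ z S d R → z * (S + suc d) + R ≡ z * S + (z * suc d + R)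
    distrib = NS.solve-∀
  A≤d+1 : A ≤ suc d
  A≤d+1 = coprime-divisor-bound d cop (∣m+n∣m⇒∣n (subst (A ∣_) (trans AC≡ (NP.+-comm (z * suc d) (A * R))) (∣m⇒∣m*n C ∣-refl))
                                                  (∣m⇒∣m*n R ∣-refl))
-- w < S:  A ∣ z(S − w), so  A R ≥ A (z + C)  and  R > z
... | tri> _ _ w<S with d , e ← NP.m≤n⇒∃[o]m+o≡n w<S =
  ⊥-elim (NP.<-irrefl refl (NP.<-≤-trans (NP.m<n+m z C≥1) (NP.≤-trans R≥z+C R≤z)))
  where
  AR≡ : z * suc d + A * C ≡ A * R
  AR≡ = NP.+-cancelˡ-≡ (z * w) _ _
          (trans (sym (distrib z w d (A * C))) (trans (cong (λ t → z * t + A * C) (trans (NP.+-suc w d) e)) key))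
    where
    distrib : ∀ z w d C → z * (w + suc d) + C ≡ z * w + (z * suc d + C)
    distrib = NS.solve-∀
  A≤d+1 : A ≤ suc d
  A≤d+1 = coprime-divisor-bound d cop (∣m+n∣m⇒∣n (subst (A ∣_) (trans (sym AR≡) (NP.+-comm (z * suc d) (A * C))) (∣m⇒∣m*n R ∣-refl))
                                                  (∣m⇒∣m*n C ∣-refl))
  R≥z+C : C + z ≤ R
  R≥z+C = NP.*-cancelˡ-≤ A ⦃ ℕ.>-nonZero A≥1 ⦄
            (NP.≤-trans (NP.≤-reflexive (NP.*-distribˡ-+ A C z))
              (NP.≤-trans (NP.+-monoʳ-≤ (A * C) (NP.≤-trans (NP.≤-reflexive (NP.*-comm A z)) (NP.*-monoʳ-≤ z A≤d+1)))
                (NP.≤-reflexive (trans (NP.+-comm (A * C) (z * suc d)) AR≡))))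

preimage-singleton : ∀ a s A C w → Shape a s A C w → ∀ x → 0 < x → parity 1 ≡ s →
  whole (cmat [ x ]) ≡ a + w → back (cmat [ x ]) ≡ A → InS a s [ x ] × (phi a s [ x ] ≡ form (+ A) (+ (a + 2 * w)) (+ C))
preimage-singleton a s A C w sh x px refl eP refl with refl ← w≡0 sh
  with refl ← trans (Shape.relation sh) (NP.*-identityˡ C)
  with refl ← trans (sym (trans (NP.+-identityʳ (x * 1)) (NP.*-identityʳ x))) (trans eP (NP.+-identityʳ a)) =
  (px ∷ [] , refl , refl) , cong (λ t → form (+ 1) (+ t) (+ 1)) (sym (NP.+-identityʳ _))

-- for length ≥ 2, coprimality of a + w and A forces [q₂…qₗ₋₁] = w and [q₁…qₗ₋₁] = C
preimage : ∀ a s A C w → 0 < a → Shape a s A C w → Coprime (a + w) A →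
  ∀ L → Pos L → parity (length L) ≡ s → whole (cmat L) ≡ a + w → back (cmat L) ≡ A →
  InS a s L × (phi a s L ≡ form (+ A) (+ (a + 2 * w)) (+ C))
preimage a s A C w a>0 sh cop [] _ _ _ eQ = ⊥-elim (NP.<⇒≢ (Shape.A≥1 sh) eQ)
preimage a s A C w a>0 sh cop (x ∷ []) (px ∷ []) par eP eQ = preimage-singleton a s A C w sh x px par eP eQ
preimage a s A C w a>0 sh cop L@(x ∷ y ∷ r) pL par eP eQ =
  ⇒InS a s L len pL (trans eP (cong (λ t → a + t) (sym S≡w))) par ,
  trans (phi≡matForm a s L len)
        (form-cong (cong +_ eQ) (cong +_ (trans (cong₂ _+_ eP S≡w) (twice a w))) (cong +_ R≡C))
  where
  open Shape sh
  twice : ∀ a w → a + w + w ≡ a + 2 * w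
  twice = NS.solve-∀
  len : 2 ≤ length L
  len = s≤s (s≤s z≤n)
  z = a + w
  S = inner (cmat L)
  R = front (cmat L)
  -- the determinant of cmat L and the shape relation have the same constants
  key : z * S + A * C ≡ z * w + A * R
  key = cross-cancel (z * S) (A * C) (z * w) (A * R) s (1 ∸ s)
          (subst₂ (λ P Q → P * S + s ≡ Q * R + (1 ∸ s)) eP eQ (determinant-parity L s par))
          (trans (cong (_+ s) (NP.*-comm z w)) (trans relation (NP.+-comm (1 ∸ s) (A * C))))
  S≡w : S ≡ w
  S≡w = coprime-box z A S w R C (CP.sym cop) A≥1 (front-pos y r (AP.++⁻ʳ [ x ] pL)) (w≤A sh a>0)
          (subst (R ≤_) eP (front≤whole x (y ∷ r) pL)) C≥1 key
  R≡C : R ≡ C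
  R≡C = sym (NP.*-cancelˡ-≡ C R A ⦃ ℕ.>-nonZero A≥1 ⦄
          (NP.+-cancelˡ-≡ (z * w) _ _ (trans (cong (λ t → z * t + A * C) (sym S≡w)) key)))

Preimage : ℕ → ℕ → Form → Set
Preimage a s f = Σ (List ℕ) λ L → InS a s L × (phi a s L ≡ f) × (psi a s f ≡ L)

surjective : ∀ a s → Admissible a s → ∀ f → InZ a s f → Preimage a s f
surjective a s H (form (+ A) (+ B) (+ C)) f∈Z@((+<+ _ , +<+ _ , +<+ B>A+C) , _)
  with w , refl , sh ← reduced-shape a s (s≤1 H) A B C f∈Z
  with c , pc , cc , eP , eQ ← canonical-expansion A A (a + w) NP.≤-refl (Shape.A≥1 sh) (A≤a+w sh) (coprime sh (s≤1 H))
  with parity-corrected s c (s≤1 H) pc cc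
... | inj₂ (pL , par , eP' , eQ')
  with L∈S , φL≡f ← preimage a s A C w (a>0 H) sh (coprime sh (s≤1 H)) (chooseParity s c) pL par (trans eP' eP) (trans eQ' eQ) =
  chooseParity s c , L∈S , φL≡f ,
  psi-canonical a s A (a + 2 * w) C c pc cc (trans (double a w) (cong (2 *_) (sym eP))) eQ
  where
  double : ∀ a w → a + (a + 2 * w) ≡ 2 * (a + w)
  double = NS.solve-∀
-- c = (1) would force a + w = 1 = A, hence B = a + 2w = 1 < A + C
... | inj₁ (refl , refl) =
  ⊥-elim (two≰one (NP.≤-trans (s≤s (NP.≤-trans (Shape.A≥1 sh) (NP.m≤m+n A C)))
                              (NP.≤-trans B>A+C (NP.≤-reflexive (B≡1 a w (a>0 H) eP)))))
  where
  two≰one : ¬ (2 ≤ 1)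
  two≰one (s≤s ())
  B≡1 : ∀ a w → 0 < a → 1 ≡ a + w → a + 2 * w ≡ 1
  B≡1 (suc zero) zero _ _ = refl
  B≡1 (suc zero) (suc w) _ ()
  B≡1 (suc (suc a)) w _ ()

zagierStep-form : ∀ n P B R →
  zagierStep n (form P B R) ≡ form (P ℤ.* n ℤ.* n ℤ.- B ℤ.* n ℤ.+ R) (+ 2 ℤ.* P ℤ.* n ℤ.- B) P
zagierStep-form n P B R = form-cong (first n P B R) (middle n P B R) (last P B R)
  where
  first : ∀ (n P B R : ℤ) → P ℤ.* n ℤ.* n ℤ.+ B ℤ.* n ℤ.* -1ℤ ℤ.+ R ℤ.* -1ℤ ℤ.* -1ℤ ≡ P ℤ.* n ℤ.* n ℤ.- B ℤ.* n ℤ.+ R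
  first = ZS.solve-∀
  middle : ∀ (n P B R : ℤ) → + 2 ℤ.* P ℤ.* n ℤ.* + 1 ℤ.+ B ℤ.* (n ℤ.* + 0 ℤ.+ + 1 ℤ.* -1ℤ) ℤ.+ + 2 ℤ.* R ℤ.* -1ℤ ℤ.* + 0
           ≡ + 2 ℤ.* P ℤ.* n ℤ.- B
  middle = ZS.solve-∀
  last : ∀ (P B R : ℤ) → P ℤ.* + 1 ℤ.* + 1 ℤ.+ B ℤ.* + 1 ℤ.* + 0 ℤ.+ R ℤ.* + 0 ℤ.* + 0 ≡ P
  last = ZS.solve-∀

ZI : ℤ → ℕ → ℤ → ℤ → Set
ZI D A B n = LtSqrt ((+ 2) ℤ.* (+ A) ℤ.* (n ℤ.- + 1) ℤ.- B) D × SqrtLt D ((+ 2) ℤ.* (+ A) ℤ.* n ℤ.- B)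

sqrt-order : ∀ (D y x : ℤ) → y ℤ.≤ x → SqrtLt D y → LtSqrt x D → ⊥
sqrt-order D .(+ k) .(+ j) (+≤+ {k} {j} k≤j) (_ , D<k²) (inj₁ (+<+ ()))
sqrt-order D .(+ k) .(+ j) (+≤+ {k} {j} k≤j) (_ , D<k²) (inj₂ j²<D) =
  ZP.<-irrefl refl (ZP.<-trans j²<D (ZP.<-≤-trans D<k² (subst₂ ℤ._≤_ (ZP.pos-* k k) (ZP.pos-* j j) (+≤+ (NP.*-mono-≤ k≤j k≤j)))))

index-bound-mono : ∀ A n m B → n ℤ.< m → (+ 2) ℤ.* (+ A) ℤ.* n ℤ.- B ℤ.≤ (+ 2) ℤ.* (+ A) ℤ.* (m ℤ.- + 1) ℤ.- B
index-bound-mono A n m B n<m =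
  subst₂ ℤ._≤_ (sym (trans (cong (λ t → t ℤ.* n ℤ.- B) (sym (ZP.pos-* 2 A))) (swap (+ (2 * A)) n B)))
    (sym (trans (cong (λ t → t ℤ.* (m ℤ.- + 1) ℤ.- B) (sym (ZP.pos-* 2 A))) (swap (+ (2 * A)) (m ℤ.- + 1) B)))
    (ZP.+-monoˡ-≤ (ℤ.- B) (ZP.*-monoʳ-≤-nonNeg (+ (2 * A)) (subst (n ℤ.≤_) (ZP.+-comm -1ℤ m) (ZP.i<j⇒i≤pred[j] n<m))))
  where
  swap : ∀ (A n B : ℤ) → A ℤ.* n ℤ.- B ≡ n ℤ.* A ℤ.+ (ℤ.- B)
  swap = ZS.solve-∀

zagierIndex-unique : ∀ D A B n m → ZI D A B n → ZI D A B m → n ≡ m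
zagierIndex-unique D A B n m (lo-n , hi-n) (lo-m , hi-m) with ZP.<-cmp n m
... | tri≈ _ e _ = e
... | tri< n<m _ _ = ⊥-elim (sqrt-order D _ _ (index-bound-mono A n m B n<m) hi-n lo-m)
... | tri> _ _ m<n = ⊥-elim (sqrt-order D _ _ (index-bound-mono A m n B m<n) hi-m lo-n)

Disc : ℕ → ℕ → ℤ
Disc a s = + discPlus a s ℤ.- + discMinus s

below-sqrt : ∀ a s X → X * X + discMinus s < discPlus a s → LtSqrt (+ X) (Disc a s)
below-sqrt a s X h = inj₂ (subst (ℤ._< Disc a s) (ZP.pos-* X X)
  (subst (+ (X * X) ℤ.<_) (sum≡⇒pos≡diff (U ∸ V) V U (NP.m∸n+n≡m V≤U)) (+<+ (NP.m+n≤o⇒m≤o∸n (suc (X * X)) h))))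
  where
  U = discPlus a s; V = discMinus s
  V≤U : V ≤ U
  V≤U = NP.m+n≤o⇒n≤o (suc (X * X)) h

diff-below : ∀ U V W → U < W + V → + U ℤ.- + V ℤ.< + W
diff-below U V W h = subst (+ U ℤ.- + V ℤ.<_) (cancel (+ W) (+ V)) (ZP.+-monoˡ-< (ℤ.- (+ V)) (+<+ h))
  where
  cancel : ∀ (W V : ℤ) → (W ℤ.+ V) ℤ.- V ≡ W
  cancel = ZS.solve-∀

negative-below-sqrt : ∀ a s U V → U < V → LtSqrt (+ U ℤ.- + V) (Disc a s)
negative-below-sqrt a s U V h = inj₁ (diff-below U V 0 h)

above-sqrt : ∀ a s Y → discPlus a s < Y * Y + discMinus s → SqrtLt (Disc a s) (+ Y)
above-sqrt a s Y h = +≤+ z≤n , subst (Disc a s ℤ.<_) (ZP.pos-* Y Y) (diff-below (discPlus a s) (discMinus s) (Y * Y) h)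

discPlus≤ : ∀ a s → discPlus a s ≤ a * a + 4
discPlus≤ a s = NP.+-monoʳ-≤ (a * a) (NP.*-monoʳ-≤ 4 (NP.m∸n≤m 1 s))

pos-2mn : ∀ (m n : ℕ) → (+ 2) ℤ.* (+ m) ℤ.* (+ n) ≡ + (2 * m * n)
pos-2mn m n = trans (cong (ℤ._* + n) (sym (ZP.pos-* 2 m))) (sym (ZP.pos-* (2 * m) n))

-- Kneading realises the Zagier step

KneadStep : ℕ → ℕ → List ℕ → ℕ → ℕ → ℕ → Set
KneadStep a s L A B C =
  InS a s (knead L) × Σ ℤ λ n₀ → ZI (Disc a s) A (+ B) n₀ × (zagierStep n₀ (form (+ A) (+ B) (+ C)) ≡ phi a s (knead L))

diff≡pos : ∀ X Y U → X ≡ U + Y → + X ℤ.- + Y ≡ + U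
diff≡pos X Y U h = trans (sum≡⇒diff≡ X Y U 0 (trans (NP.+-identityʳ X) h)) (ZP.+-identityʳ (+ U))

knead-singleton : ∀ a → 2 < a → KneadStep a 1 [ a ] 1 a 1
knead-singleton (suc zero) (s≤s ())
knead-singleton (suc (suc zero)) (s≤s (s≤s ()))
knead-singleton (suc (suc (suc h))) _ =
  ((s≤s z≤n ∷ []) , refl , refl) , + a , (below , above) ,
  trans (zagierStep-form (+ a) (+ 1) (+ a) (+ 1)) (form-cong (fixedA (+ a)) (fixedB (+ a)) refl)
  where
  a = 3 + h
  fixedA : ∀ (X : ℤ) → + 1 ℤ.* X ℤ.* X ℤ.- X ℤ.* X ℤ.+ + 1 ≡ + 1
  fixedA = ZS.solve-∀
  fixedB : ∀ (X : ℤ) → + 2 ℤ.* + 1 ℤ.* X ℤ.- X ≡ X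
  fixedB = ZS.solve-∀
  lower : ∀ (X : ℤ) → + 2 ℤ.* + 1 ℤ.* (X ℤ.- + 1) ℤ.- X ≡ X ℤ.- + 2
  lower = ZS.solve-∀
  square : ∀ h → (3 + h) * (3 + h) + 0 ≡ (suc h * suc h + 4) + suc (3 + 4 * h)
  square = NS.solve-∀
  -- a − 2 < √(a² − 4)
  below : LtSqrt (+ 2 ℤ.* + 1 ℤ.* (+ a ℤ.- + 1) ℤ.- + a) (Disc a 1)
  below = subst (λ t → LtSqrt t (Disc a 1)) (sym (trans (lower (+ a)) (diff≡pos a 2 (suc h) (cong suc (NP.+-comm 2 h)))))
            (below-sqrt a 1 (suc h) (subst (suc h * suc h + 4 <_) (sym (square h)) (NP.m<m+n _ (s≤s z≤n))))
  -- √(a² − 4) < a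
  above : SqrtLt (Disc a 1) (+ 2 ℤ.* + 1 ℤ.* + a ℤ.- + a)
  above = subst (SqrtLt (Disc a 1)) (sym (fixedB (+ a))) (above-sqrt a 1 a (NP.+-monoʳ-< (a * a) (s≤s z≤n)))

-- L = (x, 1), s = 0:  (1, x + 2, x) ↦ (x, x + 2, 1)  with n = x + 2
knead-pair : ∀ x → 0 < x → KneadStep x 0 (x ∷ 1 ∷ []) 1 (x + 2) x
knead-pair (suc x') _ =
  (s≤s z≤n ∷ s≤s z≤n ∷ [] , cong (λ u → just (+ u)) (NP.*-identityˡ x) , refl) ,
  + (x + 2) , (below , above) ,
  trans (zagierStep-form (+ (x + 2)) (+ 1) (+ (x + 2)) (+ x))
        (form-cong (swapA (+ x)) (trans (keepB (+ x)) (cong +_ (sym (B≡ x)))) refl)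
  where
  x = suc x'
  swapA : ∀ (X : ℤ) → + 1 ℤ.* (X ℤ.+ + 2) ℤ.* (X ℤ.+ + 2) ℤ.- (X ℤ.+ + 2) ℤ.* (X ℤ.+ + 2) ℤ.+ X ≡ X
  swapA = ZS.solve-∀
  keepB : ∀ (X : ℤ) → + 2 ℤ.* + 1 ℤ.* (X ℤ.+ + 2) ℤ.- (X ℤ.+ + 2) ≡ X ℤ.+ + 2
  keepB = ZS.solve-∀
  lower : ∀ (X : ℤ) → + 2 ℤ.* + 1 ℤ.* ((X ℤ.+ + 2) ℤ.- + 1) ℤ.- (X ℤ.+ + 2) ≡ X
  lower = ZS.solve-∀
  B≡ : ∀ x → 1 * x + 1 + 1 ≡ x + 2
  B≡ = NS.solve-∀
  square : ∀ x' → (suc x' + 2) * (suc x' + 2) + 0 ≡ (suc x' * suc x' + 4) + 4 * suc x'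
  square = NS.solve-∀
  -- x < √(x² + 4)
  below : LtSqrt (+ 2 ℤ.* + 1 ℤ.* (+ (x + 2) ℤ.- + 1) ℤ.- + (x + 2)) (Disc x 0)
  below = subst (λ t → LtSqrt t (Disc x 0)) (sym (lower (+ x)))
            (below-sqrt x 0 x (subst (_< x * x + 4) (sym (NP.+-identityʳ (x * x))) (NP.m<m+n _ (s≤s z≤n))))
  -- √(x² + 4) < x + 2
  above : SqrtLt (Disc x 0) (+ 2 ℤ.* + 1 ℤ.* + (x + 2) ℤ.- + (x + 2))
  above = subst (SqrtLt (Disc x 0)) (sym (keepB (+ x)))
            (above-sqrt x 0 (x + 2) (subst (x * x + 4 <_) (sym (square x')) (NP.m<m+n _ (s≤s z≤n))))

-- The step with n = X + 1 on (P, X P + K + Ρ, X Ρ + Σ), in terms of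
-- Pt = P, Qt = P − K, Rt = P − Ρ, St = Qt − (Ρ − Σ).
step-pinched : ∀ (X P K Ρ Σ Qt St Rt Pt : ℤ) → Pt ≡ P → Qt ≡ P ℤ.- K → Rt ≡ P ℤ.- Ρ → St ≡ Qt ℤ.- (Ρ ℤ.- Σ) →
  zagierStep (X ℤ.+ + 1) (form P (X ℤ.* P ℤ.+ K ℤ.+ Ρ) (X ℤ.* Ρ ℤ.+ Σ)) ≡ form (Qt ℤ.* X ℤ.+ St) (Pt ℤ.* X ℤ.+ Rt ℤ.+ Qt) Pt
step-pinched X P K Ρ Σ _ _ _ _ refl refl refl refl =
  trans (zagierStep-form (X ℤ.+ + 1) P (X ℤ.* P ℤ.+ K ℤ.+ Ρ) (X ℤ.* Ρ ℤ.+ Σ))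
        (form-cong (newA X P K Ρ Σ) (newB X P K Ρ) refl)
  where
  newA : ∀ (X P K Ρ Σ : ℤ) → P ℤ.* (X ℤ.+ + 1) ℤ.* (X ℤ.+ + 1) ℤ.- (X ℤ.* P ℤ.+ K ℤ.+ Ρ) ℤ.* (X ℤ.+ + 1) ℤ.+ (X ℤ.* Ρ ℤ.+ Σ)
                           ≡ (P ℤ.- K) ℤ.* X ℤ.+ ((P ℤ.- K) ℤ.- (Ρ ℤ.- Σ))
  newA = ZS.solve-∀
  newB : ∀ (X P K Ρ : ℤ) → + 2 ℤ.* P ℤ.* (X ℤ.+ + 1) ℤ.- (X ℤ.* P ℤ.+ K ℤ.+ Ρ) ≡ P ℤ.* X ℤ.+ (P ℤ.- Ρ) ℤ.+ (P ℤ.- K)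
  newB = ZS.solve-∀

-- The general case L = x ∷ r with r pinchable: knead L = t ++ [x], where t
-- is r pinched at both ends.  Writing cmat r = (p ρ ; κ σ), the two pinches give
--   cmat t = (p , p − ρ ; p − κ , (p − κ) − (ρ − σ)).
module DoublePinch (x : ℕ) (r : List ℕ) (pr : Pos r) (big : Pinchable r) where
  r₁ = pinchLeft r
  t = pinchRight r₁
  p = whole (cmat r); ρ = front (cmat r); κ = back (cmat r); σ = inner (cmat r)
  Pt = whole (cmat t); Rt = front (cmat t); Qt = back (cmat t); St = inner (cmat t)

  private
    left = pinchLeft-facts r pr big
    right = pinchRight-facts r₁ (proj₁ (proj₂ left)) (subst (2 ≤_) (proj₁ (proj₁ left)) big)
    relL = proj₁ left
    relR = proj₁ right

  pos-t : Pos t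
  pos-t = proj₁ (proj₂ right)

  Pt≡p : Pt ≡ p
  Pt≡p = sym (trans (proj₁ relL) (proj₁ relR))

  κ+Qt≡p : κ + Qt ≡ p
  κ+Qt≡p = subst (λ u → κ + u ≡ p) (proj₁ (proj₂ relR)) (proj₁ (proj₂ (proj₂ relL)))

  Rt+ρ≡p : Rt + ρ ≡ p
  Rt+ρ≡p = trans (NP.+-comm Rt ρ) (trans (cong (_+ Rt) (proj₁ (proj₂ relL)))
                  (trans (proj₁ (proj₂ (proj₂ relR))) (sym (proj₁ relL))))

  St≡ : + St ≡ + Qt ℤ.- (+ ρ ℤ.- + σ)
  St≡ = trans (sum≡⇒pos≡diff St S₁ Qt (trans (NP.+-comm St S₁) (trans (proj₂ (proj₂ (proj₂ relR))) (proj₁ (proj₂ relR)))))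
              (cong (λ u → + Qt ℤ.- u) (sum≡⇒pos≡diff S₁ σ ρ (trans (NP.+-comm S₁ σ) (proj₂ (proj₂ (proj₂ relL))))))
    where S₁ = inner (cmat r₁)

  -- the two pinches change the length by one each, so the parity is kept
  parity-t : parity (length t) ≡ parity (length r)
  parity-t = trans (parity-differByOne (proj₂ (proj₂ right)))
               (trans (cong (1 ∸_) (parity-differByOne (proj₂ (proj₂ left)))) (flip-flip (length r)))

  length-knead : 2 ≤ length (t ++ [ x ])
  length-knead = subst (2 ≤_) (sym (length-snoc t x)) (s≤s (nonempty t (subst (2 ≤_) (sym Pt≡p) big)))
    where
    nonempty : ∀ t → Pinchable t → 1 ≤ length t
    nonempty [] (s≤s ())
    nonempty (_ ∷ _) _ = s≤s z≤n

  -- cmat (t ++ [x]) = cmat t · M(x) = (Pt x + Rt , Pt ; Qt x + St , Qt)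
  phi-knead : ∀ a s → phi a s (t ++ [ x ]) ≡ form (+ Qt ℤ.* + x ℤ.+ + St) (+ Pt ℤ.* + x ℤ.+ + Rt ℤ.+ + Qt) (+ Pt)
  phi-knead a s = trans (phi≡matForm a s (t ++ [ x ]) length-knead)
    (trans (cong matForm (cmat-++ t [ x ]))
      (form-cong (trans (cong +_ (first x Qt St)) (cong (ℤ._+ + St) (ZP.pos-* Qt x)))
                 (trans (cong +_ (middle x Pt Rt Qt St)) (cong (λ u → u ℤ.+ + Rt ℤ.+ + Qt) (ZP.pos-* Pt x)))
                 (cong +_ (last x Pt Rt))))
    where
    first : ∀ x Qt St → Qt * (x * 1 + 0) + St * 1 ≡ Qt * x + St
    first = NS.solve-∀
    middle : ∀ x Pt Rt Qt St → Pt * (x * 1 + 0) + Rt * 1 + (Qt * (x * 0 + 1) + St * 0) ≡ Pt * x + Rt + Qt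
    middle = NS.solve-∀
    last : ∀ x Pt Rt → Pt * (x * 0 + 1) + Rt * 0 ≡ Pt
    last = NS.solve-∀

  -- alternant a of x ∷ r  (x p + κ = a + ρ)  gives alternant a of t ++ [x]
  alternant-knead : ∀ a → x * p + κ ≡ a + ρ → HasAlternant a (cmat (t ++ [ x ]))
  alternant-knead a alt = subst (λ M → whole M ≡ a + inner M) (sym (cmat-++ t [ x ]))
    (trans (cong₂ _+_ (cong (Pt *_) (trans (NP.+-identityʳ (x * 1)) (NP.*-identityʳ x))) (NP.*-identityʳ Rt))
      (trans core (cong (λ u → a + u) (sym (drop x Qt St)))))
    where
    drop : ∀ x Qt St → Qt * (x * 0 + 1) + St * 0 ≡ Qt
    drop = NS.solve-∀
    regroupˡ : ∀ Pt x Rt ρ κ → (Pt * x + Rt) + (ρ + κ) ≡ Pt * x + (Rt + ρ) + κ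
    regroupˡ = NS.solve-∀
    regroupʳ : ∀ a Qt ρ κ → (a + Qt) + (ρ + κ) ≡ (a + ρ) + (κ + Qt)
    regroupʳ = NS.solve-∀
    expand : ∀ x p κ → (x * p + κ) + p ≡ p * x + p + κ
    expand = NS.solve-∀
    core : Pt * x + Rt ≡ a + Qt
    core = NP.+-cancelʳ-≡ (ρ + κ) _ _ (begin
      (Pt * x + Rt) + (ρ + κ)   ≡⟨ regroupˡ Pt x Rt ρ κ ⟩
      Pt * x + (Rt + ρ) + κ     ≡⟨ cong₂ (λ u v → u * x + v + κ) Pt≡p Rt+ρ≡p ⟩
      p * x + p + κ             ≡⟨ sym (expand x p κ) ⟩
      (x * p + κ) + p           ≡⟨ cong₂ _+_ alt (sym κ+Qt≡p) ⟩
      (a + ρ) + (κ + Qt)        ≡⟨ sym (regroupʳ a Qt ρ κ) ⟩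
      (a + Qt) + (ρ + κ)        ∎)
      where open ≡-Reasoning

  step-knead : ∀ a s → zagierStep (+ (x + 1)) (form (+ p) (+ (x * p + κ + ρ)) (+ (x * ρ + σ))) ≡ phi a s (t ++ [ x ])
  step-knead a s =
    trans (cong (zagierStep (+ (x + 1))) lhs≡)
      (trans (step-pinched (+ x) (+ p) (+ κ) (+ ρ) (+ σ) (+ Qt) (+ St) (+ Rt) (+ Pt) (cong +_ Pt≡p)
                           (sum≡⇒pos≡diff Qt κ p (trans (NP.+-comm Qt κ) κ+Qt≡p)) (sum≡⇒pos≡diff Rt ρ p Rt+ρ≡p) St≡)
             (sym (phi-knead a s)))
    where
    lhs≡ : form (+ p) (+ (x * p + κ + ρ)) (+ (x * ρ + σ)) ≡ form (+ p) (+ x ℤ.* + p ℤ.+ + κ ℤ.+ + ρ) (+ x ℤ.* + ρ ℤ.+ + σ)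
    lhs≡ = form-cong refl (cong (λ u → u ℤ.+ + κ ℤ.+ + ρ) (ZP.pos-* x p)) (cong (ℤ._+ + σ) (ZP.pos-* x ρ))

below-gap : ∀ a s κ h → s ≤ 1 → ¬ (a ≡ 2 × s ≡ 1) → 1 ≤ κ → 2 * κ + h ≡ a → h * h + discMinus s < discPlus a s
below-gap a zero κ h _ _ _ refl =
  subst (_< (2 * κ + h) * (2 * κ + h) + 4) (sym (NP.+-identityʳ (h * h)))
    (NP.≤-<-trans (NP.*-mono-≤ (NP.m≤n+m h (2 * κ)) (NP.m≤n+m h (2 * κ))) (NP.m<m+n _ (s≤s z≤n)))
below-gap a (suc zero) (suc k) h _ not-2-1 _ refl =
  subst (h * h + 4 <_) (sym (trans (NP.+-identityʳ _) (square k h))) (NP.m<m+n (h * h + 4) (positive k h (λ { (refl , refl) → not-2-1 (refl , refl) })))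
  where
  square : ∀ k h → (2 * suc k + h) * (2 * suc k + h) ≡ (h * h + 4) + (4 * suc k * h + 8 * k + 4 * k * k)
  square = NS.solve-∀
  positive : ∀ k h → ¬ (k ≡ 0 × h ≡ 0) → 0 < 4 * suc k * h + 8 * k + 4 * k * k
  positive k (suc _) _ = s≤s z≤n
  positive (suc k) zero _ = NP.<-≤-trans (NP.<-≤-trans (s≤s z≤n) (NP.m≤n+m (8 * suc k) (4 * suc (suc k) * zero)))
                                        (NP.m≤m+n _ (4 * suc k * suc k))
  positive zero zero k,h≢0 = ⊥-elim (k,h≢0 (refl , refl))
below-gap a (suc (suc _)) _ _ (s≤s ()) _ _ _

-- For p = κ + 1 + g > κ ≥ 1 and x p + κ = a + ρ, the step on (p, x p + κ + ρ, ·)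
-- has index x + 1:   a − 2κ = 2p x − B < √D < 2p(x + 1) − B = a + 2(p − κ).
knead-index : ∀ a s x κ ρ g → Admissible a s → 1 ≤ κ → x * (κ + 1 + g) + κ ≡ a + ρ →
  ZI (Disc a s) (κ + 1 + g) (+ (x * (κ + 1 + g) + κ + ρ)) (+ (x + 1))
knead-index a s x κ ρ g H κ≥1 alt = below , above
  where
  p = κ + 1 + g
  B₀ = x * p + κ + ρ
  Y = a + 2 + 2 * g
  Y≡ : (+ 2) ℤ.* (+ p) ℤ.* (+ (x + 1)) ℤ.- + B₀ ≡ + Y
  Y≡ = trans (cong (ℤ._- + B₀) (pos-2mn p (x + 1))) (diff≡pos (2 * p * (x + 1)) B₀ Y (sym (begin
    Y + B₀                                  ≡⟨ regroup a ρ x p κ g ⟩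
    (a + ρ) + (x * p + κ) + 2 + 2 * g      ≡⟨ cong (λ t → t + (x * p + κ) + 2 + 2 * g) (sym alt) ⟩
    (x * p + κ) + (x * p + κ) + 2 + 2 * g  ≡⟨ collect x κ g ⟩
    2 * p * (x + 1)                        ∎)))
    where
    open ≡-Reasoning
    regroup : ∀ a ρ x p κ g → (a + 2 + 2 * g) + (x * p + κ + ρ) ≡ (a + ρ) + (x * p + κ) + 2 + 2 * g
    regroup = NS.solve-∀
    collect : ∀ x κ g → (x * (κ + 1 + g) + κ) + (x * (κ + 1 + g) + κ) + 2 + 2 * g ≡ 2 * (κ + 1 + g) * (x + 1)
    collect = NS.solve-∀
  above : SqrtLt (Disc a s) ((+ 2) ℤ.* (+ p) ℤ.* (+ (x + 1)) ℤ.- + B₀)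
  above = subst (SqrtLt (Disc a s)) (sym Y≡) (above-sqrt a s Y
            (NP.≤-<-trans (discPlus≤ a s) (NP.<-≤-trans (subst ((a * a + 4) <_) (sym (square a g)) (NP.m<m+n (a * a + 4) (positive a g (a>0 H))))
                                                        (NP.m≤m+n (Y * Y) (discMinus s)))))
    where
    square : ∀ a g → (a + 2 + 2 * g) * (a + 2 + 2 * g) ≡ (a * a + 4) + (4 * a + 8 * g + 4 * a * g + 4 * g * g)
    square = NS.solve-∀
    positive : ∀ a g → 0 < a → 0 < 4 * a + 8 * g + 4 * a * g + 4 * g * g
    positive (suc a) g _ = s≤s z≤n
  X≡ : (+ 2) ℤ.* (+ p) ℤ.* (+ (x + 1) ℤ.- + 1) ℤ.- + B₀ ≡ + a ℤ.- + (2 * κ)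
  X≡ = trans (cong (λ t → (+ 2) ℤ.* (+ p) ℤ.* t ℤ.- + B₀) (cancel (+ x)))
         (trans (cong (ℤ._- + B₀) (pos-2mn p x))
           (sum≡⇒diff≡ (2 * p * x) B₀ a (2 * κ) (sym (trans (regroup a ρ x p κ) (trans (cong (λ t → t + x * p + κ) (sym alt)) (collect x p κ))))))
    where
    cancel : ∀ (X : ℤ) → (X ℤ.+ + 1) ℤ.- + 1 ≡ X
    cancel = ZS.solve-∀
    regroup : ∀ a ρ x p κ → a + (x * p + κ + ρ) ≡ (a + ρ) + x * p + κ
    regroup = NS.solve-∀
    collect : ∀ x p κ → (x * p + κ) + x * p + κ ≡ 2 * p * x + 2 * κ
    collect = NS.solve-∀
  below : LtSqrt ((+ 2) ℤ.* (+ p) ℤ.* (+ (x + 1) ℤ.- + 1) ℤ.- + B₀) (Disc a s)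
  below with NP.<-≤-connex a (2 * κ)
  ... | inj₁ a<2κ = subst (λ t → LtSqrt t (Disc a s)) (sym X≡) (negative-below-sqrt a s a (2 * κ) a<2κ)
  ... | inj₂ 2κ≤a with h , e ← NP.m≤n⇒∃[o]m+o≡n 2κ≤a =
    subst (λ t → LtSqrt t (Disc a s)) (sym (trans X≡ (diff≡pos a (2 * κ) h (trans (sym e) (NP.+-comm (2 * κ) h)))))
          (below-sqrt a s h (below-gap a s κ h (s≤1 H) (not-2-1 H) κ≥1 e))

knead-general : ∀ a s → Admissible a s → ∀ x y r → InS a s (x ∷ y ∷ r) → Pinchable (y ∷ r) →
  KneadStep a s (x ∷ y ∷ r) (back (cmat (x ∷ y ∷ r))) (whole (cmat (x ∷ y ∷ r)) + inner (cmat (x ∷ y ∷ r)))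
                            (front (cmat (x ∷ y ∷ r)))
knead-general a s H x y r L∈S big
  with pL@(px ∷ pr@(_ ∷ pr')) , alt , par ← InS⇒ a s (x ∷ y ∷ r) (s≤s (s≤s z≤n)) L∈S
  with g , eg ← NP.m≤n⇒∃[o]m+o≡n (back<whole y r pr big) =
  ⇒InS a s (t ++ [ x ]) length-knead (AP.++⁺ pos-t (px ∷ [])) (alternant-knead a alt) parity-knead ,
  + (x + 1) ,
  subst (λ P → ZI (Disc a s) P (+ (x * P + κ + ρ)) (+ (x + 1))) (trans (sym (shift κ g)) eg)
        (knead-index a s x κ ρ g H (whole-pos r pr') (subst (λ P → x * P + κ ≡ a + ρ) (trans (sym eg) (shift κ g)) alt)) ,
  step-knead a s
  where
  open DoublePinch x (y ∷ r) pr big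
  shift : ∀ κ g → suc κ + g ≡ κ + 1 + g
  shift κ g = cong (_+ g) (NP.+-comm 1 κ)
  parity-knead : parity (length (t ++ [ x ])) ≡ s
  parity-knead = trans (cong parity (length-snoc t x))
    (trans (parity-suc (length t)) (trans (cong (1 ∸_) parity-t) (trans (sym (parity-suc (length (y ∷ r)))) par)))

knead-realises : ∀ a s → Admissible a s → ∀ L → InS a s L → ∀ A B C →
  phi a s L ≡ form (+ A) (+ B) (+ C) → KneadStep a s L A B C
knead-realises a s H [] (_ , () , _) A B C e
knead-realises a s H (x ∷ []) (px , alt , par) A B C e
  with refl ← ZP.+-injective (MP.just-injective alt) | refl ← par
  with eA , eB , eC ← form-injective e
  with refl ← ZP.+-injective eA | refl ← ZP.+-injective eB | refl ← ZP.+-injective eC =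
  knead-singleton a (a≥3 H)
knead-realises a s H (x ∷ y ∷ r) L∈S@(pL@(px ∷ py ∷ pr) , alt , par) A B C e with pinchable-or-one y r (py ∷ pr)
... | inj₁ refl
  with refl ← ZP.+-injective (MP.just-injective alt) | refl ← par
  with eA , eB , eC ← form-injective e
  with refl ← ZP.+-injective eA | refl ← ZP.+-injective eB | refl ← ZP.+-injective eC =
  subst₂ (λ a B → KneadStep a 0 (x ∷ 1 ∷ []) 1 B x) (sym (NP.*-identityʳ x)) (sym (B≡ x)) (knead-pair x px)
  where
  B≡ : ∀ x → x * 1 + 1 + 1 ≡ x + 2
  B≡ = NS.solve-∀
... | inj₂ big
  with eA , eB , eC ← form-injective (trans (sym (phi≡matForm a s (x ∷ y ∷ r) (s≤s (s≤s z≤n)))) e)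
  with refl ← ZP.+-injective eA | refl ← ZP.+-injective eB | refl ← ZP.+-injective eC =
  knead-general a s H x y r L∈S big

zagierStep-knead : ∀ a s → Admissible a s → (f : Form) (n : ℤ) → InZ a s f → ZagierIndex (discriminant f) f n →
  InZ a s (zagierStep n f) × psi a s (zagierStep n f) ≡ knead (psi a s f)
zagierStep-knead a s H f@(form (+ suc A') (+ B) (+ C)) n f∈Z index
  with L , L∈S , φL≡f , ψf≡L ← surjective a s H f f∈Z
  with kL∈S , n₀ , index₀ , step ← knead-realises a s H L L∈S (suc A') B C φL≡f
  with refl ← zagierIndex-unique (discriminant f) (suc A') (+ B) n n₀ index
                (subst (λ D → ZI D (suc A') (+ B) n₀) (sym (trans (proj₂ f∈Z) (disc≡ a s (s≤1 H)))) index₀)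
  = subst (λ g → InZ a s g × psi a s g ≡ knead (psi a s f)) (sym step)
      (phi-inZ a s H (knead L) kL∈S , trans (psi-phi a s H (knead L) kL∈S) (cong knead (sym ψf≡L)))
zagierStep-knead a s H (form (+ zero) B C) n ((+<+ () , _) , _) index
zagierStep-knead a s H (form (ℤ.-[1+ _ ]) B C) n ((() , _) , _) index
zagierStep-knead a s H (form (+ suc A') B (ℤ.-[1+ _ ])) n ((_ , () , _) , _) index
zagierStep-knead a s H (form (+ suc A') (ℤ.-[1+ _ ]) (+ C)) n ((_ , _ , ()) , _) index

theorem1 : (a s : ℕ) → 0 < a → s ≤ 1 → ¬ (a ≡ 1 × s ≡ 1) → ¬ (a ≡ 2 × s ≡ 1) →
    ((qs : List ℕ) → InS a s qs → InZ a s (phi a s qs))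
    × ((f : Form) → InZ a s f → InS a s (psi a s f))
    × ((qs : List ℕ) → InS a s qs → psi a s (phi a s qs) ≡ qs)
    × ((f : Form) → InZ a s f → phi a s (psi a s f) ≡ f)
    × ((f : Form) (n : ℤ) → InZ a s f → ZagierIndex (discriminant f) f n →
    InZ a s (zagierStep n f) × psi a s (zagierStep n f) ≡ knead (psi a s f))
theorem1 a s a>0 s≤1 not-1-1 not-2-1 =
  phi-inZ a s H ,
  (λ f f∈Z → let (L , L∈S , _ , ψf≡L) = surjective a s H f f∈Z in subst (InS a s) (sym ψf≡L) L∈S) ,
  psi-phi a s H ,
  (λ f f∈Z → let (L , _ , φL≡f , ψf≡L) = surjective a s H f f∈Z in trans (cong (phi a s) ψf≡L) φL≡f) ,
  zagierStep-knead a s H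
  where
  H : Admissible a s
  H = record { a>0 = a>0 ; s≤1 = s≤1 ; not-1-1 = not-1-1 ; not-2-1 = not-2-1 }
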